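{- For all $d\geq 3$, $M^{\mathbb{R}}_{\mathcal{Z}}(Q_d) \leq Z_{\pm}(Q_d) \leq 3\cdot 2^{d-3}$, where $Q_d$ is the $d$-dimensional hypercube graph.
   Context: For a simple graph $G$ on $\{1,\dots,n\}$: the graph of a real symmetric matrix $A$ is $G$ if for $i\neq j$, $A_{ij}\neq0$ iff $i\sim j$. $\mathcal{Z}$ is the family of real symmetric matrices all of whose nonzero off-diagonal entries share the same weak sign; $M^{\mathbb{R}}_{\mathcal{Z}}(G)$ is the maximum nullity of a matrix in $\mathcal{Z}$ with graph $G$. $Z_{\pm}(G)$ denotes $Z_{\pm}(P_{\mathcal{Z}}(G))$, where $P_{\mathcal{Z}}(G)$ is the sign pattern with $P_{ii}=?$, $P_{ij}=-$ if $i\sim j$, $P_{ij}=0$ otherwise. Signed zero forcing game on a sign pattern $P$ (entries in $\{+,-,0,?\}$): each vertex is black or white; a white vertex may carry a marker $m(w)\in\{+,-\}$ ($m(w)=*$ if unmarked; markers vanish when a vertex is colored black). Initially a set $S$ is black, others white and unmarked. Write $\iota(+)=-$, $\iota(-)=+$, $s\cdot t=+$ if $s=t$ and $-$ otherwise. A move: let $u$ be black, or white with $P_{uu}\neq ?$; let $W$ be the set of white $w$ (possibly $w=u$) with $P_{uw}\in\{+,-\}$; $W_+=\{w\in W: m(w)=P_{uw}\}$, $W_-=\{w\in W: m(w)\neq *, m(w)\neq P_{uw}\}$, $W_*=\{w\in W:m(w)=*\}$. (a) If $W=\{w\}$, color $w$ black. (b) If $W_+=W$ or $W_-=W$, color all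 of $W$ black. (c) If $W_s\neq\emptyset$, $W_{\iota(s)}=\emptyset$, $W_*=\{w\}$, mark $w$ with $P_{uw}\cdot\iota(s)$. (d) If no white vertex is marked, any white vertex may be marked $+$. $S$ is a signed zero forcing set if some sequence of moves makes everything black; $Z_{\pm}(P)$ is the minimum size of such a set. -}

module Defs where

open import Level using (0ℓ)
open import Data.Nat as ℕ using (ℕ; zero; suc)
open import Data.Bool using (Bool; true; false; if_then_else_)
open import Data.Vec using (Vec; []; _∷_)
open import Data.Fin using (Fin)
open import Data.Maybe using (Maybe; just; nothing)
open import Data.Product using (Σ; ∃; _×_; _,_)
open import Data.Sum using (_⊎_)
open import Relation.Nullary using (¬_)
open import Relation.Binary using (Rel; IsTotalOrder)
open import Relation.Binary.PropositionalEquality using (_≡_)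
open import Relation.Binary.Construct.Closure.ReflexiveTransitive using (Star)
open import Algebra.Structures using (IsCommutativeRing)

-- The real numbers: any complete ordered field (unique up to isomorphism).

record RealField : Set₁ where
  infixl 6 _+_
  infixl 7 _*_
  infix 4 _≈_ _≤_
  field
    Carrier : Set
    _≈_ : Rel Carrier 0ℓ
    _≤_ : Rel Carrier 0ℓ
    _+_ _*_ : Carrier → Carrier → Carrier
    -_ : Carrier → Carrier
    0# 1# : Carrier
    isCommutativeRing : IsCommutativeRing _≈_ _+_ _*_ -_ 0# 1#
    isTotalOrder : IsTotalOrder _≈_ _≤_
    0≉1 : ¬ (0# ≈ 1#)
    inverse : ∀ x → ¬ (x ≈ 0#) → ∃ λ y → x * y ≈ 1#
    +-mono : ∀ x y z → x ≤ y → x + z ≤ y + z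
    *-nonneg : ∀ x y → 0# ≤ x → 0# ≤ y → 0# ≤ x * y
    complete : (P : Carrier → Set) → (∃ λ x → P x) →
               (∃ λ b → ∀ x → P x → x ≤ b) →
               ∃ λ s → (∀ x → P x → x ≤ s) × (∀ b → (∀ x → P x → x ≤ b) → s ≤ b)

Vertex : ℕ → Set
Vertex d = Vec Bool d

hamming : ∀ {d} → Vertex d → Vertex d → ℕ
hamming [] [] = 0
hamming (true ∷ x) (true ∷ y) = hamming x y
hamming (false ∷ x) (false ∷ y) = hamming x y
hamming (true ∷ x) (false ∷ y) = suc (hamming x y)
hamming (false ∷ x) (true ∷ y) = suc (hamming x y)

Adj : ∀ {d} → Vertex d → Vertex d → Set
Adj x y = hamming x y ≡ 1

count : ∀ {d} → (Vertex d → Bool) → ℕ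
count {zero} S = if S [] then 1 else 0
count {suc d} S = count (λ x → S (false ∷ x)) ℕ.+ count (λ x → S (true ∷ x))

module LinAlg (ℝ : RealField) where
  open RealField ℝ

  sumV : ∀ {d} → (Vertex d → Carrier) → Carrier
  sumV {zero} f = f []
  sumV {suc d} f = sumV (λ x → f (false ∷ x)) + sumV (λ x → f (true ∷ x))

  sumFin : ∀ {m} → (Fin m → Carrier) → Carrier
  sumFin {zero} f = 0#
  sumFin {suc m} f = f Fin.zero + sumFin (λ k → f (Fin.suc k))

  Matrix : ℕ → Set
  Matrix d = Vertex d → Vertex d → Carrier

  Symmetric : ∀ {d} → Matrix d → Set
  Symmetric A = ∀ i j → A i j ≈ A j i

  HasGraphQ : ∀ {d} → Matrix d → Set
  HasGraphQ A = ∀ i j → ¬ (i ≡ j) → (¬ (A i j ≈ 0#) → Adj i j) × (Adj i j → ¬ (A i j ≈ 0#))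

  InZ : ∀ {d} → Matrix d → Set
  InZ A = (∀ i j → ¬ (i ≡ j) → A i j ≤ 0#) ⊎ (∀ i j → ¬ (i ≡ j) → 0# ≤ A i j)

  InKernel : ∀ {d} → Matrix d → (Vertex d → Carrier) → Set
  InKernel A v = ∀ i → sumV (λ j → A i j * v j) ≈ 0#

  LinIndep : ∀ {d m} → (Fin m → Vertex d → Carrier) → Set
  LinIndep {d} {m} vs = ∀ (c : Fin m → Carrier) → (∀ i → sumFin (λ k → c k * vs k i) ≈ 0#) → ∀ k → c k ≈ 0#

  NullityAtMost : ∀ {d} → Matrix d → ℕ → Set
  NullityAtMost {d} A n = ∀ m (vs : Fin m → Vertex d → Carrier) →
    (∀ k → InKernel A (vs k)) → LinIndep vs → m ℕ.≤ n

data Sgn : Set where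
  plus minus : Sgn

ι : Sgn → Sgn
ι plus = minus
ι minus = plus

_·_ : Sgn → Sgn → Sgn
plus · plus = plus
minus · minus = plus
plus · minus = minus
minus · plus = minus

data Entry : Set where
  sgn : Sgn → Entry
  zer : Entry
  unk : Entry

PZ : ∀ d → Vertex d → Vertex d → Entry
PZ d i j with hamming i j
... | 0 = unk
... | 1 = sgn minus
... | _ = zer

-- a vertex is black, or white with marker (nothing = unmarked *)
data Cell : Set where
  black : Cell
  white : Maybe Sgn → Cell

data Class : Set where
  c+ c- c* : Class

classOf : Maybe Sgn → Sgn → Class
classOf nothing _ = c*
classOf (just plus) plus = c+
classOf (just minus) minus = c+
classOf (just plus) minus = c-
classOf (just minus) plus = c-

classS : Sgn → Class
classS plus = c+
classS minus = c-

module Game {V : Set} (P : V → V → Entry) where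

  State : Set
  State = V → Cell

  Eligible : State → V → Set
  Eligible s u = (s u ≡ black) ⊎ (Σ (Maybe Sgn) λ m → s u ≡ white m × ¬ (P u u ≡ unk))

  InW : State → V → V → Set
  InW s u w = Σ (Maybe Sgn) λ m → Σ Sgn λ σ → s w ≡ white m × P u w ≡ sgn σ

  InWc : State → V → Class → V → Set
  InWc s u c w = Σ (Maybe Sgn) λ m → Σ Sgn λ σ →
    s w ≡ white m × P u w ≡ sgn σ × classOf m σ ≡ c

  Blacken : State → (V → Set) → State → Set
  Blacken s W s' = ∀ x → (W x → s' x ≡ black) × (¬ W x → s' x ≡ s x)

  Mark : State → V → Sgn → State → Set
  Mark s w μ s' = s' w ≡ white (just μ) × (∀ x → ¬ (x ≡ w) → s' x ≡ s x)

  data Move (s s' : State) : Set where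
    ruleA : ∀ u w → Eligible s u → InW s u w → (∀ x → InW s u x → x ≡ w) →
            Blacken s (λ x → x ≡ w) s' → Move s s'
    ruleB : ∀ u c → Eligible s u → (c ≡ c+ ⊎ c ≡ c-) →
            (∀ x → InW s u x → InWc s u c x) →
            Blacken s (InW s u) s' → Move s s'
    ruleC : ∀ u w σ τ → Eligible s u →
            (∃ λ x → InWc s u (classS σ) x) →
            (∀ x → ¬ InWc s u (classS (ι σ)) x) →
            InWc s u c* w → (∀ x → InWc s u c* x → x ≡ w) →
            P u w ≡ sgn τ →
            Mark s w (τ · ι σ) s' → Move s s'
    ruleD : ∀ w → (∀ x m → s x ≡ white m → m ≡ nothing) →
            s w ≡ white nothing → Mark s w plus s' → Move s s'

  initial : (V → Bool) → State
  initial S x = if S x then black else white nothing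

  AllBlack : State → Set
  AllBlack s = ∀ x → s x ≡ black

  SignedZFS : (V → Bool) → Set
  SignedZFS S = ∃ λ s → Star Move (initial S) s × AllBlack s

SignedZFSQ : ∀ d → (Vertex d → Bool) → Set
SignedZFSQ d = Game.SignedZFS (PZ d)

-- Let A ∈ 𝒵 have graph Q_d and let x ∈ ker A vanish on a signed zero forcing set.
-- Replaying the game keeps the invariant "x vanishes on black vertices and has sign σ on white
-- vertices marked σ", up to replacing x by −x at a rule (d) move: when A is nonpositive off the
-- diagonal, the row of A x = 0 at a black vertex is a sum whose other terms have known signs,
-- which yields exactly the conclusion of rules (a)–(c).  A nonnegative A is reduced to this case by
-- conjugating with the ±1 parity signs of the bipartite cube.  Hence x = 0; as more than |S|
-- independent kernel vectors would have a nontrivial combination vanishing on S, nullity A ≤ |S|.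
-- Equality of reals is not decidable, so the argument runs in the double-negation monad, which is
-- harmless for the final inequality between natural numbers.
--
-- In Q_{3+k} the set {000, 100, 010} × Q_k forces: every 000y forces 001y; then in
-- every column y rule (d) marks 011y, rule (c) marks 110y from 010y and 101y from 100y, rule (b)
-- from 001y blackens 101y and 011y, and rule (a) from 010y blackens 110y; finally every 110y
-- forces 111y.

module Submission where

open import Defs
open import Level using (0ℓ)
open import Algebra.Bundles using (CommutativeRing)
open import Data.Bool using (Bool; true; false; not; _xor_; if_then_else_)
import Data.Bool.Properties as Bool
open import Data.Empty using (⊥; ⊥-elim)
open import Data.Fin using (Fin)
open import Data.List using (List; []; _∷_; length; map; _++_)
open import Data.List.Membership.Propositional using (_∈_)
open import Data.List.Membership.Propositional.Properties using (∈-map⁺; ∈-++⁺ˡ; ∈-++⁺ʳ)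
open import Data.List.Relation.Unary.All as All using (All; []; _∷_)
import Data.List.Relation.Unary.All.Properties as All
open import Data.List.Relation.Unary.Any as Any using (Any; here; there; _─_)
import Data.List.Relation.Unary.Any.Properties as Any
import Data.List.Properties as List
open import Data.Maybe using (just; nothing)
open import Data.Nat as ℕ using (ℕ; zero; suc)
import Data.Nat.Properties as ℕ
open import Data.Product using (Σ; ∃; _×_; _,_; proj₁; proj₂)
open import Data.Sum using (_⊎_; inj₁; inj₂; swap)
open import Data.Unit using (⊤; tt)
open import Data.Vec using ([]; _∷_)
open import Data.Vec.Properties using (≡-dec)
open import Effect.Monad using (RawMonad)
open import Function using (id; _∘_; case_of_)
open import Relation.Binary.Construct.Closure.ReflexiveTransitive using (Star; ε; _◅_; _◅◅_)
open import Relation.Binary.PropositionalEquality using (_≡_; _≢_; _≗_; refl; sym; trans; cong; cong₂; subst; module ≡-Reasoning)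
open import Relation.Nullary using (¬_; Dec; yes; no)
open import Relation.Nullary.Negation using (¬¬-Monad; DoubleNegation)
open import Relation.Nullary.Decidable using (¬¬-excluded-middle)
open import Data.Nat.Tactic.RingSolver using (solve-∀)

open RawMonad {0ℓ} ¬¬-Monad using (pure; _>>=_; _<$>_)

_≟ᵥ_ : ∀ {d} (x y : Vertex d) → Dec (x ≡ y)
_≟ᵥ_ = ≡-dec Bool._≟_

hamming-refl : ∀ {d} (x : Vertex d) → hamming x x ≡ 0
hamming-refl [] = refl
hamming-refl (true ∷ x) = hamming-refl x
hamming-refl (false ∷ x) = hamming-refl x

hamming≡0⇒≡ : ∀ {d} (x y : Vertex d) → hamming x y ≡ 0 → x ≡ y
hamming≡0⇒≡ [] [] _ = refl
hamming≡0⇒≡ (true ∷ x) (true ∷ y) h = cong (true ∷_) (hamming≡0⇒≡ x y h)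
hamming≡0⇒≡ (false ∷ x) (false ∷ y) h = cong (false ∷_) (hamming≡0⇒≡ x y h)

suc-hamming≡1⇒≡ : ∀ {d} (x y : Vertex d) → suc (hamming x y) ≡ 1 → x ≡ y
suc-hamming≡1⇒≡ x y h = hamming≡0⇒≡ x y (ℕ.suc-injective h)

Adj⇒≢ : ∀ {d} (x y : Vertex d) → Adj x y → x ≢ y
Adj⇒≢ x .x h refl with trans (sym (hamming-refl x)) h
... | ()

elements : ∀ {d} → (Vertex d → Bool) → List (Vertex d)
elements {zero} S = if S [] then [] ∷ [] else []
elements {suc d} S = map (false ∷_) (elements (S ∘ (false ∷_))) ++ map (true ∷_) (elements (S ∘ (true ∷_)))

length-elements : ∀ {d} (S : Vertex d → Bool) → length (elements S) ≡ count S
length-elements {zero} S with S []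
... | true = refl
... | false = refl
length-elements {suc d} S = begin
  length (map (false ∷_) L₀ ++ map (true ∷_) L₁)         ≡⟨ List.length-++ (map (false ∷_) L₀) ⟩
  length (map (false ∷_) L₀) ℕ.+ length (map (true ∷_) L₁)  ≡⟨ cong₂ ℕ._+_ (List.length-map _ L₀) (List.length-map _ L₁) ⟩
  length L₀ ℕ.+ length L₁                                ≡⟨ cong₂ ℕ._+_ (length-elements (S ∘ (false ∷_))) (length-elements (S ∘ (true ∷_))) ⟩
  count (S ∘ (false ∷_)) ℕ.+ count (S ∘ (true ∷_))      ∎
  where
  open ≡-Reasoning
  L₀ = elements (S ∘ (false ∷_))
  L₁ = elements (S ∘ (true ∷_))

∈-elements : ∀ {d} (S : Vertex d → Bool) v → S v ≡ true → v ∈ elements S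
∈-elements {zero} S [] Sv rewrite Sv = here refl
∈-elements {suc d} S (false ∷ v) Sv = ∈-++⁺ˡ (∈-map⁺ (false ∷_) (∈-elements (S ∘ (false ∷_)) v Sv))
∈-elements {suc d} S (true ∷ v) Sv =
  ∈-++⁺ʳ (map (false ∷_) (elements (S ∘ (false ∷_)))) (∈-map⁺ (true ∷_) (∈-elements (S ∘ (true ∷_)) v Sv))

-- PZ is defined by a `with` on the distance; entryAt repeats that case split.
entryAt : ℕ → Entry
entryAt 0 = unk
entryAt 1 = sgn minus
entryAt (suc (suc _)) = zer

PZ≡entryAt : ∀ d (x y : Vertex d) → PZ d x y ≡ entryAt (hamming x y)
PZ≡entryAt d x y with hamming x y
... | 0 = refl
... | 1 = refl
... | suc (suc _) = refl

PZ-diagonal : ∀ {d} (x : Vertex d) → PZ d x x ≡ unk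
PZ-diagonal {d} x = trans (PZ≡entryAt d x x) (cong entryAt (hamming-refl x))

PZ-adjacent : ∀ {d} (x y : Vertex d) → Adj x y → PZ d x y ≡ sgn minus
PZ-adjacent {d} x y h = trans (PZ≡entryAt d x y) (cong entryAt h)

PZ-sgn⇒Adj : ∀ {d} (x y : Vertex d) {σ} → PZ d x y ≡ sgn σ → Adj x y × σ ≡ minus
PZ-sgn⇒Adj {d} x y e = lemma (hamming x y) (trans (sym (PZ≡entryAt d x y)) e)
  where
  lemma : ∀ {σ} n → entryAt n ≡ sgn σ → n ≡ 1 × σ ≡ minus
  lemma 1 refl = refl , refl

parity : ∀ {d} → Vertex d → Bool
parity [] = false
parity (b ∷ x) = b xor parity x

parity-Adj : ∀ {d} (x y : Vertex d) → Adj x y → parity x ≡ not (parity y)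
parity-Adj [] [] ()
parity-Adj (true ∷ x) (true ∷ y) h = cong not (parity-Adj x y h)
parity-Adj (false ∷ x) (false ∷ y) h = parity-Adj x y h
parity-Adj (true ∷ x) (false ∷ y) h = cong (not ∘ parity) (suc-hamming≡1⇒≡ x y h)
parity-Adj (false ∷ x) (true ∷ y) h =
  trans (cong parity (suc-hamming≡1⇒≡ x y h)) (sym (Bool.not-involutive (parity y)))

ι-involutive : ∀ σ → ι (ι σ) ≡ σ
ι-involutive plus = refl
ι-involutive minus = refl

≡⊎≡ι : ∀ σ τ → τ ≡ σ ⊎ τ ≡ ι σ
≡⊎≡ι plus plus = inj₁ refl
≡⊎≡ι plus minus = inj₂ refl
≡⊎≡ι minus plus = inj₂ refl
≡⊎≡ι minus minus = inj₁ refl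

minus·ι : ∀ σ → minus · ι σ ≡ σ
minus·ι plus = refl
minus·ι minus = refl

classOf-just : ∀ μ τ → classOf (just μ) τ ≡ classS (μ · τ)
classOf-just plus plus = refl
classOf-just plus minus = refl
classOf-just minus plus = refl
classOf-just minus minus = refl

classOf-minus : ∀ m σ → classOf m minus ≡ classS σ → m ≡ just (ι σ)
classOf-minus (just plus) minus refl = refl
classOf-minus (just minus) plus refl = refl

¬¬-∀ᵥ : ∀ {d} {Q : Vertex d → Set} → (∀ v → DoubleNegation (Q v)) → DoubleNegation (∀ v → Q v)
¬¬-∀ᵥ {zero} h = (λ q → λ { [] → q }) <$> h []
¬¬-∀ᵥ {suc d} h =
  ¬¬-∀ᵥ (λ v → h (false ∷ v)) >>= λ q₀ →
  ¬¬-∀ᵥ (λ v → h (true ∷ v)) >>= λ q₁ →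
  pure λ { (false ∷ v) → q₀ v ; (true ∷ v) → q₁ v }

¬¬-∀ᵥ-except : ∀ {d} {Q : Vertex d → Set} w →
  (∀ v → v ≢ w → DoubleNegation (Q v)) → DoubleNegation (∀ v → v ≢ w → Q v)
¬¬-∀ᵥ-except {Q = Q} w h = ¬¬-∀ᵥ λ v → case-≟ v
  where
  case-≟ : ∀ v → DoubleNegation (v ≢ w → Q v)
  case-≟ v with v ≟ᵥ w
  ... | yes v≡w = pure λ v≢w → ⊥-elim (v≢w v≡w)
  ... | no v≢w = (λ q _ → q) <$> h v v≢w

¬¬-All : ∀ {A : Set} {Q : A → Set} xs → ¬ Any (λ x → ¬ Q x) xs → DoubleNegation (All Q xs)
¬¬-All [] _ = pure []
¬¬-All (x ∷ xs) h = (λ ¬q → h (here ¬q)) >>= λ q → (q ∷_) <$> ¬¬-All xs (h ∘ there)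

module _ (ℝ : RealField) where
  open RealField ℝ
  open LinAlg ℝ

  private
    commutativeRing : CommutativeRing 0ℓ 0ℓ
    commutativeRing = record { isCommutativeRing = isCommutativeRing }

  open CommutativeRing commutativeRing
    using (+-cong; *-cong; -‿cong; -‿inverseˡ; -‿inverseʳ; distribˡ; zeroˡ; zeroʳ;
           +-identityˡ; +-identityʳ; *-identityˡ; *-identityʳ; +-assoc; *-assoc; +-comm; *-comm; setoid; ring)
    renaming (refl to ≈-refl; sym to ≈-sym; trans to ≈-trans; reflexive to ≈-reflexive)
  open import Algebra.Properties.Ring ring
    using (-‿distribˡ-*; -‿distribʳ-*; -‿involutive; -0#≈0#; -‿+-comm; -1*x≈-x)
  open import Relation.Binary.Structures using (IsTotalOrder)
  open import Algebra.Properties.Group (CommutativeRing.+-group commutativeRing) using (inverseˡ-unique; x∙y⁻¹≈ε⇒x≈y)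
  open IsTotalOrder isTotalOrder using (antisym; total; ≲-respˡ-≈; ≲-respʳ-≈)
    renaming (reflexive to ≤-reflexive; trans to ≤-trans)
  open import Relation.Binary.Reasoning.Setoid setoid

  ≤-resp-≈ : ∀ {a b c e} → a ≈ b → c ≈ e → a ≤ c → b ≤ e
  ≤-resp-≈ a≈b c≈e = ≲-respʳ-≈ c≈e ∘ ≲-respˡ-≈ a≈b

  -‿antitone : ∀ {a b} → a ≤ b → - b ≤ - a
  -‿antitone {a} {b} a≤b = ≤-resp-≈ left right (+-mono a b (- a + - b) a≤b)
    where
    left : a + (- a + - b) ≈ - b
    left = begin
      a + (- a + - b)  ≈⟨ +-assoc a (- a) (- b) ⟨
      (a + - a) + - b  ≈⟨ +-cong (-‿inverseʳ a) ≈-refl ⟩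
      0# + - b         ≈⟨ +-identityˡ (- b) ⟩
      - b              ∎
    right : b + (- a + - b) ≈ - a
    right = begin
      b + (- a + - b)  ≈⟨ +-cong ≈-refl (+-comm (- a) (- b)) ⟩
      b + (- b + - a)  ≈⟨ +-assoc b (- b) (- a) ⟨
      (b + - b) + - a  ≈⟨ +-cong (-‿inverseʳ b) ≈-refl ⟩
      0# + - a         ≈⟨ +-identityˡ (- a) ⟩
      - a              ∎

  x≈0⇒-x≈0 : ∀ {a} → a ≈ 0# → - a ≈ 0#
  x≈0⇒-x≈0 a≈0 = ≈-trans (-‿cong a≈0) -0#≈0#

  -x≈0⇒x≈0 : ∀ {a} → - a ≈ 0# → a ≈ 0#
  -x≈0⇒x≈0 {a} e = ≈-trans (≈-sym (-‿involutive a)) (x≈0⇒-x≈0 e)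

  -x*-y≈x*y : ∀ a b → - a * - b ≈ a * b
  -x*-y≈x*y a b = begin
    - a * - b      ≈⟨ -‿distribˡ-* a (- b) ⟨
    - (a * - b)    ≈⟨ -‿cong (-‿distribʳ-* a b) ⟨
    - - (a * b)    ≈⟨ -‿involutive (a * b) ⟩
    a * b          ∎

  Signed : Sgn → Carrier → Set
  Signed plus a = 0# ≤ a
  Signed minus a = a ≤ 0#

  Signed-neg : ∀ σ {a} → Signed σ a → Signed (ι σ) (- a)
  Signed-neg plus h = ≤-resp-≈ ≈-refl -0#≈0# (-‿antitone h)
  Signed-neg minus h = ≤-resp-≈ -0#≈0# ≈-refl (-‿antitone h)

  Signed-resp : ∀ σ {a b} → a ≈ b → Signed σ a → Signed σ b
  Signed-resp plus a≈b = ≤-resp-≈ ≈-refl a≈b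
  Signed-resp minus a≈b = ≤-resp-≈ a≈b ≈-refl

  Signed-≈0 : ∀ σ {a} → a ≈ 0# → Signed σ a
  Signed-≈0 plus a≈0 = ≤-reflexive (≈-sym a≈0)
  Signed-≈0 minus a≈0 = ≤-reflexive a≈0

  Signed-ι⇒≈0 : ∀ σ {a} → Signed σ a → Signed (ι σ) a → a ≈ 0#
  Signed-ι⇒≈0 plus 0≤a a≤0 = antisym a≤0 0≤a
  Signed-ι⇒≈0 minus a≤0 0≤a = antisym a≤0 0≤a

  Signed-total : ∀ σ a → Signed σ a ⊎ Signed (ι σ) a
  Signed-total plus a = swap (total a 0#)
  Signed-total minus a = total a 0#

  nonpos*Signed : ∀ σ {a b} → a ≤ 0# → Signed σ b → Signed (ι σ) (a * b)
  nonpos*Signed plus {a} {b} a≤0 0≤b = Signed-resp minus (-‿involutive (a * b))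
    (Signed-neg plus (≤-resp-≈ ≈-refl (≈-sym (-‿distribˡ-* a b)) (*-nonneg _ _ (Signed-neg minus a≤0) 0≤b)))
  nonpos*Signed minus {a} {b} a≤0 b≤0 =
    ≤-resp-≈ ≈-refl (-x*-y≈x*y a b) (*-nonneg _ _ (Signed-neg minus a≤0) (Signed-neg minus b≤0))

  nonzero*≈0⇒≈0 : ∀ {a b} → ¬ a ≈ 0# → a * b ≈ 0# → b ≈ 0#
  nonzero*≈0⇒≈0 {a} {b} a≉0 ab≈0 with inverse a a≉0
  ... | a⁻¹ , aa⁻¹≈1 = begin
    b                ≈⟨ *-identityˡ b ⟨
    1# * b           ≈⟨ *-cong (≈-trans (*-comm a⁻¹ a) aa⁻¹≈1) ≈-refl ⟨
    (a⁻¹ * a) * b    ≈⟨ *-assoc a⁻¹ a b ⟩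
    a⁻¹ * (a * b)    ≈⟨ *-cong ≈-refl ab≈0 ⟩
    a⁻¹ * 0#         ≈⟨ zeroʳ a⁻¹ ⟩
    0#               ∎

  neg*Signed⇒Signed : ∀ σ {a b} → a ≤ 0# → ¬ a ≈ 0# → Signed (ι σ) (a * b) → Signed σ b
  neg*Signed⇒Signed σ {a} {b} a≤0 a≉0 hab with Signed-total σ b
  ... | inj₁ hb = hb
  ... | inj₂ hb = Signed-≈0 σ (nonzero*≈0⇒≈0 a≉0 (Signed-ι⇒≈0 (ι σ) hab (nonpos*Signed (ι σ) a≤0 hb)))

  +-Signed : ∀ σ {a b} → Signed σ a → Signed σ b → Signed σ (a + b)
  +-Signed plus {a} {b} 0≤a 0≤b = ≤-trans (≤-resp-≈ ≈-refl (≈-sym (+-identityˡ b)) 0≤b) (+-mono 0# a b 0≤a)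
  +-Signed minus {a} {b} a≤0 b≤0 = ≤-trans (+-mono a 0# b a≤0) (≤-resp-≈ (≈-sym (+-identityˡ b)) ≈-refl b≤0)

  +-Signed-≈0ˡ : ∀ σ {a b} → Signed σ a → Signed σ b → a + b ≈ 0# → a ≈ 0#
  +-Signed-≈0ˡ σ {a} {b} ha hb a+b≈0 =
    Signed-ι⇒≈0 σ ha (Signed-resp (ι σ) (≈-sym (inverseˡ-unique a b a+b≈0)) (Signed-neg σ hb))

  +-Signed-≈0ʳ : ∀ σ {a b} → Signed σ a → Signed σ b → a + b ≈ 0# → b ≈ 0#
  +-Signed-≈0ʳ σ {a} {b} ha hb a+b≈0 = +-Signed-≈0ˡ σ hb ha (≈-trans (+-comm b a) a+b≈0)

  sumV-cong : ∀ {d} {f g : Vertex d → Carrier} → (∀ j → f j ≈ g j) → sumV f ≈ sumV g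
  sumV-cong {zero} f≈g = f≈g []
  sumV-cong {suc d} f≈g = +-cong (sumV-cong (f≈g ∘ (false ∷_))) (sumV-cong (f≈g ∘ (true ∷_)))

  sumV-neg : ∀ {d} (f : Vertex d → Carrier) → sumV (λ j → - f j) ≈ - sumV f
  sumV-neg {zero} f = ≈-refl
  sumV-neg {suc d} f = ≈-trans (+-cong (sumV-neg (f ∘ (false ∷_))) (sumV-neg (f ∘ (true ∷_)))) (-‿+-comm _ _)

  sumV-*ˡ : ∀ {d} c (f : Vertex d → Carrier) → sumV (λ j → c * f j) ≈ c * sumV f
  sumV-*ˡ {zero} c f = ≈-refl
  sumV-*ˡ {suc d} c f =
    ≈-trans (+-cong (sumV-*ˡ c (f ∘ (false ∷_))) (sumV-*ˡ c (f ∘ (true ∷_)))) (≈-sym (distribˡ c _ _))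

  sumV-Signed : ∀ σ {d} (f : Vertex d → Carrier) → (∀ j → Signed σ (f j)) → Signed σ (sumV f)
  sumV-Signed σ {zero} f hf = hf []
  sumV-Signed σ {suc d} f hf =
    +-Signed σ (sumV-Signed σ (f ∘ (false ∷_)) (hf ∘ (false ∷_))) (sumV-Signed σ (f ∘ (true ∷_)) (hf ∘ (true ∷_)))

  sumV-Signed-≈0 : ∀ σ {d} (f : Vertex d → Carrier) → (∀ j → Signed σ (f j)) → sumV f ≈ 0# → ∀ j → f j ≈ 0#
  sumV-Signed-≈0 σ {zero} f hf Σf≈0 [] = Σf≈0
  sumV-Signed-≈0 σ {suc d} f hf Σf≈0 (false ∷ j) = sumV-Signed-≈0 σ (f ∘ (false ∷_)) (hf ∘ (false ∷_))
    (+-Signed-≈0ˡ σ (sumV-Signed σ _ (hf ∘ (false ∷_))) (sumV-Signed σ _ (hf ∘ (true ∷_))) Σf≈0) j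
  sumV-Signed-≈0 σ {suc d} f hf Σf≈0 (true ∷ j) = sumV-Signed-≈0 σ (f ∘ (true ∷_)) (hf ∘ (true ∷_))
    (+-Signed-≈0ʳ σ (sumV-Signed σ _ (hf ∘ (false ∷_))) (sumV-Signed σ _ (hf ∘ (true ∷_))) Σf≈0) j

  sumV-≈0⇒Signed-at : ∀ σ {d} (f : Vertex d → Carrier) w →
    (∀ j → j ≢ w → Signed σ (f j)) → sumV f ≈ 0# → Signed (ι σ) (f w)
  sumV-≈0⇒Signed-at σ f w hf Σf≈0 with Signed-total σ (f w)
  ... | inj₂ hw = hw
  ... | inj₁ hw = Signed-≈0 (ι σ) (sumV-Signed-≈0 σ f all Σf≈0 w)
    where
    all : ∀ j → Signed σ (f j)
    all j with j ≟ᵥ w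
    ... | yes refl = hw
    ... | no j≢w = hf j j≢w

  sumFin-cong : ∀ {m} {f g : Fin m → Carrier} → (∀ k → f k ≈ g k) → sumFin f ≈ sumFin g
  sumFin-cong {zero} f≈g = ≈-refl
  sumFin-cong {suc m} f≈g = +-cong (f≈g Fin.zero) (sumFin-cong (f≈g ∘ Fin.suc))

  sumFin-≈0 : ∀ {m} (f : Fin m → Carrier) → (∀ k → f k ≈ 0#) → sumFin f ≈ 0#
  sumFin-≈0 {zero} f f≈0 = ≈-refl
  sumFin-≈0 {suc m} f f≈0 = ≈-trans (+-cong (f≈0 Fin.zero) (sumFin-≈0 (f ∘ Fin.suc) (f≈0 ∘ Fin.suc))) (+-identityˡ 0#)

  sumFin-+ : ∀ {m} (f g : Fin m → Carrier) → sumFin (λ k → f k + g k) ≈ sumFin f + sumFin g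
  sumFin-+ {zero} f g = ≈-sym (+-identityˡ 0#)
  sumFin-+ {suc m} f g = begin
    (f₀ + g₀) + sumFin (λ k → f (Fin.suc k) + g (Fin.suc k))  ≈⟨ +-cong ≈-refl (sumFin-+ (f ∘ Fin.suc) (g ∘ Fin.suc)) ⟩
    (f₀ + g₀) + (F + G)                                        ≈⟨ +-assoc f₀ g₀ (F + G) ⟩
    f₀ + (g₀ + (F + G))                                        ≈⟨ +-cong ≈-refl (+-assoc g₀ F G) ⟨
    f₀ + ((g₀ + F) + G)                                        ≈⟨ +-cong ≈-refl (+-cong (+-comm g₀ F) ≈-refl) ⟩
    f₀ + ((F + g₀) + G)                                        ≈⟨ +-cong ≈-refl (+-assoc F g₀ G) ⟩
    f₀ + (F + (g₀ + G))                                        ≈⟨ +-assoc f₀ F (g₀ + G) ⟨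
    (f₀ + F) + (g₀ + G)                                        ∎
    where
    f₀ = f Fin.zero
    g₀ = g Fin.zero
    F = sumFin (f ∘ Fin.suc)
    G = sumFin (g ∘ Fin.suc)

  sumFin-*ˡ : ∀ {m} c (f : Fin m → Carrier) → sumFin (λ k → c * f k) ≈ c * sumFin f
  sumFin-*ˡ {zero} c f = ≈-sym (zeroʳ c)
  sumFin-*ˡ {suc m} c f = ≈-trans (+-cong ≈-refl (sumFin-*ˡ c (f ∘ Fin.suc))) (≈-sym (distribˡ c _ _))

  sumFin-neg : ∀ {m} (f : Fin m → Carrier) → sumFin (λ k → - f k) ≈ - sumFin f
  sumFin-neg {zero} f = ≈-sym -0#≈0#
  sumFin-neg {suc m} f = ≈-trans (+-cong ≈-refl (sumFin-neg (f ∘ Fin.suc))) (-‿+-comm _ _)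

  sumV-sumFin-comm : ∀ {d m} (f : Vertex d → Fin m → Carrier) →
    sumV (λ j → sumFin (f j)) ≈ sumFin (λ k → sumV (λ j → f j k))
  sumV-sumFin-comm {zero} f = ≈-refl
  sumV-sumFin-comm {suc d} f =
    ≈-trans (+-cong (sumV-sumFin-comm (f ∘ (false ∷_))) (sumV-sumFin-comm (f ∘ (true ∷_))))
            (≈-sym (sumFin-+ (λ k → sumV (λ j → f (false ∷ j) k)) (λ k → sumV (λ j → f (true ∷ j) k))))

  sumV-≈0⇒≈0-at : ∀ {d} (f : Vertex d → Carrier) w → (∀ j → j ≢ w → f j ≈ 0#) → sumV f ≈ 0# → f w ≈ 0#
  sumV-≈0⇒≈0-at f w others Σf≈0 = Signed-ι⇒≈0 minus
    (sumV-≈0⇒Signed-at plus f w (λ j j≢w → Signed-≈0 plus (others j j≢w)) Σf≈0)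
    (sumV-≈0⇒Signed-at minus f w (λ j j≢w → Signed-≈0 minus (others j j≢w)) Σf≈0)

  InKernel-neg : ∀ {d} {A : Matrix d} {x} → InKernel A x → InKernel A (λ v → - x v)
  InKernel-neg {A = A} {x} ker i = begin
    sumV (λ j → A i j * - x j)    ≈⟨ sumV-cong (λ j → -‿distribʳ-* (A i j) (x j)) ⟨
    sumV (λ j → - (A i j * x j))  ≈⟨ sumV-neg (λ j → A i j * x j) ⟩
    - sumV (λ j → A i j * x j)    ≈⟨ x≈0⇒-x≈0 (ker i) ⟩
    0#                            ∎

  Consistent : Cell → Carrier → Set
  Consistent black a = a ≈ 0#
  Consistent (white nothing) a = ⊤
  Consistent (white (just σ)) a = Signed σ a

  record Agrees {d} (s : Vertex d → Cell) (x : Vertex d → Carrier) : Set where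
    constructor agreeing
    field at : ∀ v → Consistent (s v) (x v)

  module Soundness {d} (A : Matrix d) (graph : HasGraphQ A) (adj-nonpos : ∀ {i j} → Adj i j → A i j ≤ 0#) where
    open Game (PZ d)

    adj-nonzero : ∀ i j → Adj i j → ¬ A i j ≈ 0#
    adj-nonzero i j h = proj₂ (graph i j (Adj⇒≢ i j h)) h

    consistent-at : ∀ {s x} {v : Vertex d} {c} → Agrees s x → s v ≡ c → Consistent c (x v)
    consistent-at {x = x} {v} agree e = subst (λ c → Consistent c (x v)) e (Agrees.at agree v)

    Eligible⇒black : ∀ s u → Eligible s u → s u ≡ black
    Eligible⇒black s u (inj₁ e) = e
    Eligible⇒black s u (inj₂ (_ , _ , not-unk)) = ⊥-elim (not-unk (PZ-diagonal u))

    InW⇒InWc : ∀ {s u j} → InW s u j → InWc s u c* j ⊎ Σ Sgn λ σ → InWc s u (classS σ) j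
    InW⇒InWc (nothing , τ , sj , pz) = inj₁ (nothing , τ , sj , pz , refl)
    InW⇒InWc (just μ , τ , sj , pz) = inj₂ (μ · τ , just μ , τ , sj , pz , classOf-just μ τ)

    Agrees-Blacken : ∀ {s s' x} {W : Vertex d → Set} → Blacken s W s' → Agrees s x →
      (∀ v → W v → x v ≈ 0#) → DoubleNegation (Agrees s' x)
    Agrees-Blacken {x = x} bl agree W≈0 = agreeing <$> ¬¬-∀ᵥ λ v → ¬¬-excluded-middle >>= λ where
      (yes Wv) → pure (subst (λ c → Consistent c (x v)) (sym (proj₁ (bl v) Wv)) (W≈0 v Wv))
      (no ¬Wv) → pure (subst (λ c → Consistent c (x v)) (sym (proj₂ (bl v) ¬Wv)) (Agrees.at agree v))

    Agrees-Mark : ∀ {s s' x w μ} → Mark s w μ s' → Agrees s x → Signed μ (x w) → Agrees s' x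
    Agrees-Mark {s' = s'} {x} {w} (marked , others) agree hw = agreeing at
      where
      at : ∀ v → Consistent (s' v) (x v)
      at v with v ≟ᵥ w
      ... | yes refl = subst (λ c → Consistent c (x w)) (sym marked) hw
      ... | no v≢w = subst (λ c → Consistent c (x v)) (sym (others v v≢w)) (Agrees.at agree v)

    module Row (s : State) {x} (ker : InKernel A x) (agree : Agrees s x) (u : Vertex d) (u-black : s u ≡ black) where
      term : Vertex d → Carrier
      term j = A u j * x j

      term-outside-W : ∀ j → ¬ InW s u j → DoubleNegation (term j ≈ 0#)
      term-outside-W j j∉W with j ≟ᵥ u | hamming u j ℕ.≟ 1
      ... | yes refl | _ = pure (≈-trans (*-cong ≈-refl (consistent-at agree u-black)) (zeroʳ _))
      ... | no j≢u | no ¬adj = λ ¬term≈0 → ¬adj (proj₁ (graph u j (j≢u ∘ sym))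
                                 λ Auj≈0 → ¬term≈0 (≈-trans (*-cong Auj≈0 ≈-refl) (zeroˡ _)))
      ... | no _ | yes adj = by-colour (s j) refl
        where
        by-colour : ∀ c → s j ≡ c → DoubleNegation (term j ≈ 0#)
        by-colour black sj = pure (≈-trans (*-cong ≈-refl (consistent-at agree sj)) (zeroʳ _))
        by-colour (white m) sj = ⊥-elim (j∉W (m , minus , sj , PZ-adjacent u j adj))

      term-in-class : ∀ σ {j} → InWc s u (classS σ) j → Signed σ (term j)
      term-in-class σ {j} (m , τ , sj , pz , cls) with PZ-sgn⇒Adj u j pz
      ... | adj , refl = subst (λ τ → Signed τ (term j)) (ι-involutive σ)
        (nonpos*Signed (ι σ) (adj-nonpos adj)
          (consistent-at agree (trans sj (cong white (classOf-minus m σ cls)))))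

      term-in-W : ∀ {j} → InW s u j → term j ≈ 0# → x j ≈ 0#
      term-in-W {j} (_ , _ , _ , pz) = nonzero*≈0⇒≈0 (adj-nonzero u j (proj₁ (PZ-sgn⇒Adj u j pz)))

    Agrees-ruleB : ∀ σ {s s' u} → Eligible s u → (∀ j → InW s u j → InWc s u (classS σ) j) →
      Blacken s (InW s u) s' → ∀ x → InKernel A x → Agrees s x → DoubleNegation (Agrees s' x)
    Agrees-ruleB σ {s} {u = u} el W⊆Wσ bl x ker agree =
      ¬¬-∀ᵥ signed >>= λ all-signed →
      Agrees-Blacken bl agree λ v v∈W → term-in-W v∈W (sumV-Signed-≈0 σ term all-signed (ker u) v)
      where
      open Row s ker agree u (Eligible⇒black s u el)
      signed : ∀ j → DoubleNegation (Signed σ (term j))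
      signed j = ¬¬-excluded-middle >>= λ where
        (yes j∈W) → pure (term-in-class σ (W⊆Wσ j j∈W))
        (no j∉W) → Signed-≈0 σ <$> term-outside-W j j∉W

    Agrees-step : ∀ {s s'} → Move s s' → ∀ x → InKernel A x → Agrees s x →
      DoubleNegation (Agrees s' x ⊎ Agrees s' (λ v → - x v))
    Agrees-step {s} (ruleA u w el w∈W W≡w bl) x ker agree = inj₁ <$> (
      ¬¬-∀ᵥ-except w (λ j j≢w → term-outside-W j (j≢w ∘ W≡w j)) >>= λ others →
      Agrees-Blacken bl agree λ { v refl → term-in-W w∈W (sumV-≈0⇒≈0-at term w others (ker u)) })
      where open Row s ker agree u (Eligible⇒black s u el)
    Agrees-step (ruleB u .c+ el (inj₁ refl) W⊆Wc bl) x ker agree = inj₁ <$> Agrees-ruleB plus el W⊆Wc bl x ker agree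
    Agrees-step (ruleB u .c- el (inj₂ refl) W⊆Wc bl) x ker agree = inj₁ <$> Agrees-ruleB minus el W⊆Wc bl x ker agree
    Agrees-step {s} (ruleC u w σ τ el _ no-ισ w∈W* W*≡w pz mark) x ker agree
      with PZ-sgn⇒Adj u w pz
    ... | adj , refl = inj₁ <$> (
      ¬¬-∀ᵥ-except w signed >>= λ others →
      pure (Agrees-Mark mark agree (subst (λ μ → Signed μ (x w)) (sym (minus·ι σ))
        (neg*Signed⇒Signed σ (adj-nonpos adj) (adj-nonzero u w adj) (sumV-≈0⇒Signed-at σ term w others (ker u))))))
      where
      open Row s ker agree u (Eligible⇒black s u el)
      signed : ∀ j → j ≢ w → DoubleNegation (Signed σ (term j))
      signed j j≢w = ¬¬-excluded-middle >>= λ where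
        (no j∉W) → Signed-≈0 σ <$> term-outside-W j j∉W
        (yes j∈W) → case InW⇒InWc {s} {u} {j} j∈W of λ where
          (inj₁ j∈W*) → ⊥-elim (j≢w (W*≡w j j∈W*))
          (inj₂ (σ' , j∈Wσ')) → case ≡⊎≡ι σ σ' of λ where
            (inj₁ refl) → pure (term-in-class σ j∈Wσ')
            (inj₂ refl) → ⊥-elim (no-ισ j j∈Wσ')
    Agrees-step {s} (ruleD w unmarked _ mark) x ker agree with Signed-total plus (x w)
    ... | inj₁ 0≤xw = pure (inj₁ (Agrees-Mark mark agree 0≤xw))
    ... | inj₂ xw≤0 = pure (inj₂ (Agrees-Mark mark agree-neg (Signed-neg minus xw≤0)))
      where
      agree-neg : Agrees s (λ v → - x v)
      agree-neg = agreeing at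
        where
        at : ∀ v → Consistent (s v) (- x v)
        at v with s v in sv
        ... | black = x≈0⇒-x≈0 (consistent-at agree sv)
        ... | white m rewrite unmarked v m sv = tt

    forcing-zero : ∀ {s t} → Star Move s t → AllBlack t →
      ∀ x → InKernel A x → Agrees s x → DoubleNegation (∀ v → x v ≈ 0#)
    forcing-zero ε all-black x ker agree = pure λ v → consistent-at agree (all-black v)
    forcing-zero (move ◅ moves) all-black x ker agree = Agrees-step move x ker agree >>= λ where
      (inj₁ agree') → forcing-zero moves all-black x ker agree'
      (inj₂ agree') → (λ -x≈0 v → -x≈0⇒x≈0 (-x≈0 v)) <$> forcing-zero moves all-black _ (InKernel-neg ker) agree'

  Agrees-initial : ∀ {d} (S : Vertex d → Bool) {x} →
    (∀ v → S v ≡ true → x v ≈ 0#) → Agrees (Game.initial (PZ d) S) x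
  Agrees-initial S {x} S⇒x≈0 = agreeing at
    where
    at : ∀ v → Consistent (Game.initial (PZ _) S v) (x v)
    at v with S v in Sv
    ... | true = S⇒x≈0 v Sv
    ... | false = tt

  nonpos-forcing-zero : ∀ {d} (A : Matrix d) → HasGraphQ A → (∀ {i j} → Adj i j → A i j ≤ 0#) →
    ∀ S → SignedZFSQ d S → ∀ x → InKernel A x → (∀ v → S v ≡ true → x v ≈ 0#) →
    DoubleNegation (∀ v → x v ≈ 0#)
  nonpos-forcing-zero A graph adj-nonpos S (_ , moves , all-black) x ker S⇒x≈0 =
    Soundness.forcing-zero A graph adj-nonpos moves all-black x ker (Agrees-initial S S⇒x≈0)

  -- Conjugating by the diagonal ±1 matrix of vertex parities negates exactly the edge entries,
  -- since Q_d is bipartite; this turns a nonnegative matrix in 𝒵 into a nonpositive one.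

  sign : Bool → Carrier
  sign true = - 1#
  sign false = 1#

  sign² : ∀ b → sign b * sign b ≈ 1#
  sign² true = ≈-trans (-x*-y≈x*y 1# 1#) (*-identityˡ 1#)
  sign² false = *-identityˡ 1#

  sign-not : ∀ b → sign (not b) * sign b ≈ - 1#
  sign-not true = *-identityˡ (- 1#)
  sign-not false = *-identityʳ (- 1#)

  sign*[sign*x]≈x : ∀ b a → sign b * (sign b * a) ≈ a
  sign*[sign*x]≈x b a = begin
    sign b * (sign b * a)  ≈⟨ *-assoc (sign b) (sign b) a ⟨
    (sign b * sign b) * a  ≈⟨ *-cong (sign² b) ≈-refl ⟩
    1# * a                 ≈⟨ *-identityˡ a ⟩
    a                      ∎

  sign*≈0⇒≈0 : ∀ b {a} → sign b * a ≈ 0# → a ≈ 0#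
  sign*≈0⇒≈0 b {a} e = ≈-trans (≈-sym (sign*[sign*x]≈x b a)) (≈-trans (*-cong ≈-refl e) (zeroʳ _))

  paritySign : ∀ {d} → Vertex d → Carrier
  paritySign v = sign (parity v)

  conjugate : ∀ {d} → Matrix d → Matrix d
  conjugate A i j = paritySign j * (paritySign i * A i j)

  conjugate-Adj : ∀ {d} (A : Matrix d) i j → Adj i j → conjugate A i j ≈ - A i j
  conjugate-Adj A i j adj = begin
    paritySign j * (paritySign i * A i j)           ≈⟨ *-assoc (paritySign j) (paritySign i) (A i j) ⟨
    (paritySign j * paritySign i) * A i j           ≈⟨ *-cong (*-comm (paritySign j) (paritySign i)) ≈-refl ⟩
    (paritySign i * paritySign j) * A i j           ≈⟨ *-cong (*-cong (≈-reflexive i-sign) ≈-refl) ≈-refl ⟩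
    (sign (not (parity j)) * paritySign j) * A i j  ≈⟨ *-cong (sign-not (parity j)) ≈-refl ⟩
    - 1# * A i j                                    ≈⟨ -1*x≈-x (A i j) ⟩
    - A i j                                         ∎
    where
    i-sign : paritySign i ≡ sign (not (parity j))
    i-sign = cong sign (parity-Adj i j adj)

  conjugate-≈0 : ∀ {d} (A : Matrix d) i j → A i j ≈ 0# → conjugate A i j ≈ 0#
  conjugate-≈0 A i j e = ≈-trans (*-cong ≈-refl (≈-trans (*-cong ≈-refl e) (zeroʳ _))) (zeroʳ _)

  conjugate-HasGraphQ : ∀ {d} {A : Matrix d} → HasGraphQ A → HasGraphQ (conjugate A)
  conjugate-HasGraphQ {A = A} graph i j i≢j =
    (λ ¬c≈0 → proj₁ (graph i j i≢j) (¬c≈0 ∘ conjugate-≈0 A i j)) ,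
    (λ adj c≈0 → proj₂ (graph i j i≢j) adj (sign*≈0⇒≈0 (parity i) (sign*≈0⇒≈0 (parity j) c≈0)))

  conjugate-InKernel : ∀ {d} {A : Matrix d} {x} → InKernel A x → InKernel (conjugate A) (λ v → paritySign v * x v)
  conjugate-InKernel {A = A} {x} ker i = begin
    sumV (λ j → conjugate A i j * (paritySign j * x j))  ≈⟨ sumV-cong term ⟩
    sumV (λ j → paritySign i * (A i j * x j))           ≈⟨ sumV-*ˡ (paritySign i) (λ j → A i j * x j) ⟩
    paritySign i * sumV (λ j → A i j * x j)             ≈⟨ *-cong ≈-refl (ker i) ⟩
    paritySign i * 0#                                   ≈⟨ zeroʳ _ ⟩
    0#                                                  ∎
    where
    term : ∀ j → conjugate A i j * (paritySign j * x j) ≈ paritySign i * (A i j * x j)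
    term j = begin
      (εj * (εi * a)) * (εj * xj)  ≈⟨ *-cong (*-comm εj (εi * a)) ≈-refl ⟩
      ((εi * a) * εj) * (εj * xj)  ≈⟨ *-assoc (εi * a) εj (εj * xj) ⟩
      (εi * a) * (εj * (εj * xj))  ≈⟨ *-cong ≈-refl (sign*[sign*x]≈x (parity j) xj) ⟩
      (εi * a) * xj                ≈⟨ *-assoc εi a xj ⟩
      εi * (a * xj)                ∎
      where
      εi = paritySign i
      εj = paritySign j
      a = A i j
      xj = x j

  forcing-zero : ∀ {d} (A : Matrix d) → HasGraphQ A → InZ A →
    ∀ S → SignedZFSQ d S → ∀ x → InKernel A x → (∀ v → S v ≡ true → x v ≈ 0#) →
    DoubleNegation (∀ v → x v ≈ 0#)
  forcing-zero A graph (inj₁ nonpos) = nonpos-forcing-zero A graph (λ {i} {j} adj → nonpos i j (Adj⇒≢ i j adj))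
  forcing-zero A graph (inj₂ nonneg) S zfs x ker S⇒x≈0 =
    (λ εx≈0 v → sign*≈0⇒≈0 (parity v) (εx≈0 v)) <$>
    nonpos-forcing-zero (conjugate A) (conjugate-HasGraphQ graph) adj-nonpos S zfs _ (conjugate-InKernel ker)
      (λ v Sv → ≈-trans (*-cong ≈-refl (S⇒x≈0 v Sv)) (zeroʳ _))
    where
    adj-nonpos : ∀ {i j} → Adj i j → conjugate A i j ≤ 0#
    adj-nonpos {i} {j} adj = Signed-resp minus (≈-sym (conjugate-Adj A i j adj)) (Signed-neg plus (nonneg i j (Adj⇒≢ i j adj)))

  dot : ∀ {m} → (Fin m → Carrier) → (Fin m → Carrier) → Carrier
  dot r c = sumFin (λ k → c k * r k)

  NontrivialSolution : ∀ m → List (Fin m → Carrier) → Set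
  NontrivialSolution m rows = Σ (Fin m → Carrier) λ c → ¬ (∀ k → c k ≈ 0#) × All (λ r → dot r c ≈ 0#) rows

  dot-eliminate : ∀ {m} (a e c : Fin m → Carrier) b → dot (λ k → a k + - (b * e k)) c ≈ dot a c + - (b * dot e c)
  dot-eliminate a e c b = begin
    sumFin (λ k → c k * (a k + - (b * e k)))             ≈⟨ sumFin-cong (λ k → termwise (c k) (a k) (e k)) ⟩
    sumFin (λ k → c k * a k + - (b * (c k * e k)))       ≈⟨ sumFin-+ (λ k → c k * a k) (λ k → - (b * (c k * e k))) ⟩
    dot a c + sumFin (λ k → - (b * (c k * e k)))         ≈⟨ +-cong ≈-refl (sumFin-neg (λ k → b * (c k * e k))) ⟩
    dot a c + - sumFin (λ k → b * (c k * e k))           ≈⟨ +-cong ≈-refl (-‿cong (sumFin-*ˡ b (λ k → c k * e k))) ⟩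
    dot a c + - (b * dot e c)                            ∎
    where
    termwise : ∀ c a e → c * (a + - (b * e)) ≈ c * a + - (b * (c * e))
    termwise c a e = begin
      c * (a + - (b * e))       ≈⟨ distribˡ c a (- (b * e)) ⟩
      c * a + c * - (b * e)     ≈⟨ +-cong ≈-refl (-‿distribʳ-* c (b * e)) ⟨
      c * a + - (c * (b * e))   ≈⟨ +-cong ≈-refl (-‿cong (≈-trans (≈-sym (*-assoc c b e))
                                     (≈-trans (*-cong (*-comm c b) ≈-refl) (*-assoc b c e)))) ⟩
      c * a + - (b * (c * e))   ∎

  -[x*y]*z+[z*x]*y≈0 : ∀ x y z → - (x * y) * z + (z * x) * y ≈ 0#
  -[x*y]*z+[z*x]*y≈0 x y z = begin
    - (x * y) * z + (z * x) * y  ≈⟨ +-cong (-‿distribˡ-* (x * y) z) ≈-refl ⟨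
    - ((x * y) * z) + (z * x) * y ≈⟨ +-cong (-‿cong xyz≈zxy) ≈-refl ⟩
    - ((z * x) * y) + (z * x) * y ≈⟨ -‿inverseˡ _ ⟩
    0#                            ∎
    where
    xyz≈zxy : (x * y) * z ≈ (z * x) * y
    xyz≈zxy = begin
      (x * y) * z  ≈⟨ *-comm (x * y) z ⟩
      z * (x * y)  ≈⟨ *-assoc z x y ⟨
      (z * x) * y  ∎

  -- Gaussian elimination on the first coordinate, inside the double-negation monad since
  -- finding a pivot means deciding whether field elements vanish.
  underdetermined-nontrivial : ∀ m (rows : List (Fin m → Carrier)) → length rows ℕ.< m →
    DoubleNegation (NontrivialSolution m rows)
  underdetermined-nontrivial (suc m) rows len<m = ¬¬-excluded-middle >>= λ where
      (no no-pivot) → (λ all0 → e₀ , e₀-nonzero , All.map (λ {r} → dot-e₀ r) all0) <$> ¬¬-All rows no-pivot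
      (yes pivot) → eliminate pivot
    where
    e₀ : Fin (suc m) → Carrier
    e₀ Fin.zero = 1#
    e₀ (Fin.suc k) = 0#

    e₀-nonzero : ¬ (∀ k → e₀ k ≈ 0#)
    e₀-nonzero e₀≈0 = 0≉1 (≈-sym (e₀≈0 Fin.zero))

    dot-e₀ : ∀ r → r Fin.zero ≈ 0# → dot r e₀ ≈ 0#
    dot-e₀ r r₀≈0 = ≈-trans (+-cong (≈-trans (*-identityˡ _) r₀≈0)
      (sumFin-≈0 (λ k → 0# * r (Fin.suc k)) (λ k → zeroˡ _))) (+-identityˡ 0#)

    eliminate : Any (λ r → ¬ r Fin.zero ≈ 0#) rows → DoubleNegation (NontrivialSolution (suc m) rows)
    eliminate pivot with inverse (r Fin.zero) (Any.lookup-result pivot)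
      where r = Any.lookup pivot
    ... | y , r₀y≈1 =
      underdetermined-nontrivial m (map reduce (rows ─ pivot)) len'<m >>= λ where
        (c' , c'-nontrivial , reduced-solved) →
          pure (extend c' , (λ c≈0 → c'-nontrivial (c≈0 ∘ Fin.suc)) ,
                All.─⁻ pivot (pivot-solved c') (All.map (λ {q} → others-solved c' q) (All.map⁻ reduced-solved)))
      where
      r = Any.lookup pivot
      reduce : (Fin (suc m) → Carrier) → Fin m → Carrier
      reduce q k = q (Fin.suc k) + - ((q Fin.zero * y) * r (Fin.suc k))

      len'<m : length (map reduce (rows ─ pivot)) ℕ.< m
      len'<m = subst (ℕ._< m) (sym (List.length-map reduce (rows ─ pivot)))
        (ℕ.≤-pred (subst (ℕ._< suc m) (List.length-removeAt′ rows (Any.index pivot)) len<m))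

      D : (Fin m → Carrier) → Carrier
      D c' = dot (r ∘ Fin.suc) c'

      extend : (Fin m → Carrier) → Fin (suc m) → Carrier
      extend c' Fin.zero = - (y * D c')
      extend c' (Fin.suc k) = c' k

      pivot-solved : ∀ c' → dot r (extend c') ≈ 0#
      pivot-solved c' = begin
        - (y * D c') * r Fin.zero + D c'   ≈⟨ +-cong ≈-refl (*-identityˡ (D c')) ⟨
        - (y * D c') * r Fin.zero + 1# * D c'  ≈⟨ +-cong ≈-refl (*-cong r₀y≈1 ≈-refl) ⟨
        - (y * D c') * r Fin.zero + (r Fin.zero * y) * D c'  ≈⟨ -[x*y]*z+[z*x]*y≈0 y (D c') (r Fin.zero) ⟩
        0#                                 ∎

      others-solved : ∀ c' q → dot (reduce q) c' ≈ 0# → dot q (extend c') ≈ 0#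
      others-solved c' q reduced≈0 = begin
        - (y * D c') * q Fin.zero + dot (q ∘ Fin.suc) c'  ≈⟨ +-cong ≈-refl (x∙y⁻¹≈ε⇒x≈y _ _
            (≈-trans (≈-sym (dot-eliminate (q ∘ Fin.suc) (r ∘ Fin.suc) c' (q Fin.zero * y))) reduced≈0)) ⟩
        - (y * D c') * q Fin.zero + (q Fin.zero * y) * D c'  ≈⟨ -[x*y]*z+[z*x]*y≈0 y (D c') (q Fin.zero) ⟩
        0#                                                ∎

  nullity-bound : ∀ {d} (A : Matrix d) → HasGraphQ A → InZ A → ∀ S → SignedZFSQ d S → NullityAtMost A (count S)
  nullity-bound A graph inZ S zfs m vs ker independent with m ℕ.≤? count S
  ... | yes m≤∣S∣ = m≤∣S∣
  ... | no m≰∣S∣ = ⊥-elim (absurd id)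
    where
    rows : List (Fin m → Carrier)
    rows = map (λ v k → vs k v) (elements S)

    few-rows : length rows ℕ.< m
    few-rows = subst (ℕ._< m) (sym (trans (List.length-map _ (elements S)) (length-elements S))) (ℕ.≰⇒> m≰∣S∣)

    combination : (Fin m → Carrier) → Vertex _ → Carrier
    combination c v = sumFin (λ k → c k * vs k v)

    combination-InKernel : ∀ c → InKernel A (combination c)
    combination-InKernel c i = begin
      sumV (λ j → A i j * sumFin (λ k → c k * vs k j))    ≈⟨ sumV-cong distribute ⟩
      sumV (λ j → sumFin (λ k → c k * (A i j * vs k j)))  ≈⟨ sumV-sumFin-comm (λ j k → c k * (A i j * vs k j)) ⟩
      sumFin (λ k → sumV (λ j → c k * (A i j * vs k j)))  ≈⟨ sumFin-cong (λ k → sumV-*ˡ (c k) (λ j → A i j * vs k j)) ⟩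
      sumFin (λ k → c k * sumV (λ j → A i j * vs k j))    ≈⟨ sumFin-≈0 _ (λ k → ≈-trans (*-cong ≈-refl (ker k i)) (zeroʳ _)) ⟩
      0#                                                  ∎
      where
      distribute : ∀ j → A i j * sumFin (λ k → c k * vs k j) ≈ sumFin (λ k → c k * (A i j * vs k j))
      distribute j = ≈-trans (≈-sym (sumFin-*ˡ (A i j) (λ k → c k * vs k j)))
        (sumFin-cong λ k → ≈-trans (≈-sym (*-assoc (A i j) (c k) (vs k j)))
          (≈-trans (*-cong (*-comm (A i j) (c k)) ≈-refl) (*-assoc (c k) (A i j) (vs k j))))

    absurd : DoubleNegation ⊥
    absurd = underdetermined-nontrivial m rows few-rows >>= λ where
      (c , nontrivial , solved) →
        forcing-zero A graph inZ S zfs (combination c) (combination-InKernel c)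
          (λ v Sv → All.lookup (All.map⁻ solved) (∈-elements S v Sv)) >>= λ combination≈0 →
        pure (nontrivial (independent c combination≈0))

-- Not opened earlier: inside the module above these names are the field operations.
open import Data.Nat using (_≤_; _+_; _*_; _^_; _∸_; z≤n; s≤s)

module Plays {V : Set} (P : V → V → Entry) where
  open Game P

  Eligible-resp : ∀ {s s₁ u} → s ≗ s₁ → Eligible s u → Eligible s₁ u
  Eligible-resp {u = u} s≗s₁ (inj₁ e) = inj₁ (trans (sym (s≗s₁ u)) e)
  Eligible-resp {u = u} s≗s₁ (inj₂ (m , e , ne)) = inj₂ (m , trans (sym (s≗s₁ u)) e , ne)

  InW-resp : ∀ {s s₁ u w} → s ≗ s₁ → InW s u w → InW s₁ u w
  InW-resp {w = w} s≗s₁ (m , σ , e , p) = m , σ , trans (sym (s≗s₁ w)) e , p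

  InWc-resp : ∀ {s s₁ u c w} → s ≗ s₁ → InWc s u c w → InWc s₁ u c w
  InWc-resp {w = w} s≗s₁ (m , σ , e , p , q) = m , σ , trans (sym (s≗s₁ w)) e , p , q

  Move-resp : ∀ {s s₁ t} → s ≗ s₁ → Move s t → Move s₁ t
  Move-resp h (ruleA u w el w∈W W≡w bl) =
    ruleA u w (Eligible-resp h el) (InW-resp h w∈W) (λ x → W≡w x ∘ InW-resp (sym ∘ h))
      (λ x → proj₁ (bl x) , λ x≢w → trans (proj₂ (bl x) x≢w) (h x))
  Move-resp h (ruleB u c el c± W⊆Wc bl) =
    ruleB u c (Eligible-resp h el) c± (λ x → InWc-resp h ∘ W⊆Wc x ∘ InW-resp (sym ∘ h))
      (λ x → proj₁ (bl x) ∘ InW-resp (sym ∘ h) , λ x∉W → trans (proj₂ (bl x) (x∉W ∘ InW-resp h)) (h x))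
  Move-resp h (ruleC u w σ τ el (v , v∈Wσ) no-ισ w∈W* W*≡w pz (marked , others)) =
    ruleC u w σ τ (Eligible-resp h el) (v , InWc-resp h v∈Wσ) (λ x → no-ισ x ∘ InWc-resp (sym ∘ h))
      (InWc-resp h w∈W*) (λ x → W*≡w x ∘ InWc-resp (sym ∘ h)) pz
      (marked , λ x x≢w → trans (others x x≢w) (h x))
  Move-resp h (ruleD w unmarked w-white (marked , others)) =
    ruleD w (λ x m e → unmarked x m (trans (h x) e)) (trans (sym (h w)) w-white)
      (marked , λ x x≢w → trans (others x x≢w) (h x))

  -- States are functions, so without extensionality a play only determines its states up to ≗.
  infix 4 _⇝_
  _⇝_ : State → State → Set
  s ⇝ t = ∀ {s₁} → s ≗ s₁ → Σ State λ t₁ → t ≗ t₁ × Star Move s₁ t₁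

  ⇝-move : ∀ {s t} → Move s t → s ⇝ t
  ⇝-move move s≗s₁ = _ , (λ _ → refl) , (Move-resp s≗s₁ move ◅ ε)

  ⇝-≗ : ∀ {s t} → t ≗ s → s ⇝ t
  ⇝-≗ t≗s {s₁} s≗s₁ = s₁ , (λ x → trans (t≗s x) (s≗s₁ x)) , ε

  infixr 5 _▸_
  _▸_ : ∀ {s t u} → s ⇝ t → t ⇝ u → s ⇝ u
  (s⇝t ▸ t⇝u) s≗s₁ with s⇝t s≗s₁
  ... | t₁ , t≗t₁ , play₁ with t⇝u t≗t₁
  ... | u₁ , u≗u₁ , play₂ = u₁ , u≗u₁ , (play₁ ◅◅ play₂)

  ⇝-SignedZFS : ∀ {S t} → initial S ⇝ t → AllBlack t → SignedZFS S
  ⇝-SignedZFS init⇝t all-black with init⇝t (λ _ → refl)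
  ... | t₁ , t≗t₁ , play = t₁ , play , λ x → trans (sym (t≗t₁ x)) (all-black x)

  -- In a family F, D y says whether the column of y has been processed.
  Step : ∀ {k} → ((Vertex k → Bool) → State) → Set
  Step {k} F = ∀ D D' y → D y ≡ false → D' y ≡ true → (∀ z → z ≢ y → D z ≡ D' z) → F D ⇝ F D'

  Resp : ∀ {k} → ((Vertex k → Bool) → State) → Set
  Resp {k} F = ∀ D D' → D ≗ D' → F D ≗ F D'

  sweep : ∀ k (F : (Vertex k → Bool) → State) → Step F → Resp F → F (λ _ → false) ⇝ F (λ _ → true)
  sweep zero F step resp = step _ _ [] refl refl λ { [] []≢[] → ⊥-elim ([]≢[] refl) }
  sweep (suc k) F step resp =
    ⇝-≗ (resp _ _ λ { (false ∷ _) → refl ; (true ∷ _) → refl }) ▸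
    sweep k (λ E → F (split E (λ _ → false))) step₀ (λ D D' D≗D' → resp _ _ (split-cong D≗D' (λ _ → refl))) ▸
    sweep k (λ E → F (split (λ _ → true) E)) step₁ (λ D D' D≗D' → resp _ _ (split-cong (λ _ → refl) D≗D')) ▸
    ⇝-≗ (resp _ _ λ { (false ∷ _) → refl ; (true ∷ _) → refl })
    where
    split : (Vertex k → Bool) → (Vertex k → Bool) → Vertex (suc k) → Bool
    split D₀ D₁ (false ∷ z) = D₀ z
    split D₀ D₁ (true ∷ z) = D₁ z

    split-cong : ∀ {D₀ D₀' D₁ D₁'} → D₀ ≗ D₀' → D₁ ≗ D₁' → split D₀ D₁ ≗ split D₀' D₁'
    split-cong e₀ e₁ (false ∷ z) = e₀ z
    split-cong e₀ e₁ (true ∷ z) = e₁ z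

    step₀ : Step (λ E → F (split E (λ _ → false)))
    step₀ D D' y Dy D'y others = step _ _ (false ∷ y) Dy D'y
      λ { (false ∷ z) z≢y → others z (z≢y ∘ cong (false ∷_)) ; (true ∷ z) _ → refl }

    step₁ : Step (λ E → F (split (λ _ → true) E))
    step₁ D D' y Dy D'y others = step _ _ (true ∷ y) Dy D'y
      λ { (false ∷ z) _ → refl ; (true ∷ z) z≢y → others z (z≢y ∘ cong (true ∷_)) }

module CubeMoves (d : ℕ) where
  open Game (PZ d)

  force : ∀ {s s' m} u w → s u ≡ black → s w ≡ white m → Adj u w →
    (∀ x {m'} → Adj u x → s x ≡ white m' → x ≡ w) →
    s' w ≡ black → (∀ x → x ≢ w → s' x ≡ s x) → Move s s'
  force {m = m} u w u-black w-white adj only-w s'w others =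
    ruleA u w (inj₁ u-black) (m , minus , w-white , PZ-adjacent u w adj)
      (λ { x (_ , _ , sx , pz) → only-w x (proj₁ (PZ-sgn⇒Adj u x pz)) sx })
      (λ x → (λ { refl → s'w }) , others x)

  forceMarked : ∀ {s s'} u μ → s u ≡ black →
    (∀ x {m} → Adj u x → s x ≡ white m → m ≡ just μ) → Blacken s (InW s u) s' → Move s s'
  forceMarked {s} u μ u-black all-μ bl =
    ruleB u (classS (μ · minus)) (inj₁ u-black) (classS-± (μ · minus)) all-class bl
    where
    classS-± : ∀ σ → classS σ ≡ c+ ⊎ classS σ ≡ c-
    classS-± plus = inj₁ refl
    classS-± minus = inj₂ refl
    all-class : ∀ x → InW s u x → InWc s u (classS (μ · minus)) x
    all-class x (m , τ , sx , pz) with PZ-sgn⇒Adj u x pz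
    ... | adj , refl with all-μ x adj sx
    ... | refl = just μ , minus , sx , pz , classOf-just μ minus

  markVia : ∀ {s s'} u w σ → s u ≡ black →
    (∃ λ v → Adj u v × s v ≡ white (just (ι σ))) →
    (∀ x {μ} → Adj u x → s x ≡ white (just μ) → μ ≡ ι σ) →
    s w ≡ white nothing → Adj u w → (∀ x → Adj u x → s x ≡ white nothing → x ≡ w) →
    Mark s w σ s' → Move s s'
  markVia {s} {s'} u w σ u-black (v , adj-v , v-marked) all-ισ w-white adj-w only-w (marked , others) =
    ruleC u w σ minus (inj₁ u-black)
      (v , just (ι σ) , minus , v-marked , PZ-adjacent u v adj-v , classOf-ι σ) no-ισ
      (nothing , minus , w-white , PZ-adjacent u w adj-w , refl) W*≡w (PZ-adjacent u w adj-w)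
      (subst (λ μ → s' w ≡ white (just μ)) (sym (minus·ι σ)) marked , others)
    where
    classOf-ι : ∀ σ → classOf (just (ι σ)) minus ≡ classS σ
    classOf-ι plus = refl
    classOf-ι minus = refl
    ι-fixed : ∀ σ → σ ≢ ι σ
    ι-fixed plus ()
    ι-fixed minus ()
    no-ισ : ∀ x → ¬ InWc s u (classS (ι σ)) x
    no-ισ x (m , τ , sx , pz , cls) with PZ-sgn⇒Adj u x pz
    ... | adj , refl with classOf-minus m (ι σ) cls
    ... | refl = ι-fixed σ (trans (sym (ι-involutive σ)) (all-ισ x adj sx))
    W*≡w : ∀ x → InWc s u c* x → x ≡ w
    W*≡w x (nothing , τ , sx , pz , _) = only-w x (proj₁ (PZ-sgn⇒Adj u x pz)) sx
    W*≡w x (just plus , plus , _ , _ , ())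
    W*≡w x (just plus , minus , _ , _ , ())
    W*≡w x (just minus , plus , _ , _ , ())
    W*≡w x (just minus , minus , _ , _ , ())

module Construction (k : ℕ) where
  Q : ℕ
  Q = suc (suc (suc k))

  open Game (PZ Q)
  open Plays (PZ Q)
  open CubeMoves Q

  v000 v100 v010 v001 v110 v101 v011 v111 : Vertex k → Vertex Q
  v000 y = false ∷ false ∷ false ∷ y
  v100 y = true ∷ false ∷ false ∷ y
  v010 y = false ∷ true ∷ false ∷ y
  v001 y = false ∷ false ∷ true ∷ y
  v110 y = true ∷ true ∷ false ∷ y
  v101 y = true ∷ false ∷ true ∷ y
  v011 y = false ∷ true ∷ true ∷ y
  v111 y = true ∷ true ∷ true ∷ y

  S : Vertex Q → Bool
  S (false ∷ false ∷ false ∷ _) = true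
  S (true ∷ false ∷ false ∷ _) = true
  S (false ∷ true ∷ false ∷ _) = true
  S (_ ∷ _ ∷ _ ∷ _) = false

  unmarked : Cell
  unmarked = white nothing

  blackIf : Bool → Cell
  blackIf true = black
  blackIf false = unmarked

  column : ∀ {y z : Vertex k} → suc (hamming y z) ≡ 1 → z ≡ y
  column {y} {z} h = sym (suc-hamming≡1⇒≡ y z h)

  one-bit-apart : ∀ (y : Vertex k) → suc (hamming y y) ≡ 1
  one-bit-apart y = cong suc (hamming-refl y)

  -- Phase 1: each v000 y forces v001 y; D records the columns done so far.
  phase₁ : (Vertex k → Bool) → State
  phase₁ D (false ∷ false ∷ false ∷ y) = black
  phase₁ D (true ∷ false ∷ false ∷ y) = black
  phase₁ D (false ∷ true ∷ false ∷ y) = black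
  phase₁ D (false ∷ false ∷ true ∷ y) = blackIf (D y)
  phase₁ D (_ ∷ _ ∷ _ ∷ y) = unmarked

  initial≗phase₁ : initial S ≗ phase₁ (λ _ → false)
  initial≗phase₁ (false ∷ false ∷ false ∷ y) = refl
  initial≗phase₁ (true ∷ false ∷ false ∷ y) = refl
  initial≗phase₁ (false ∷ true ∷ false ∷ y) = refl
  initial≗phase₁ (false ∷ false ∷ true ∷ y) = refl
  initial≗phase₁ (true ∷ true ∷ false ∷ y) = refl
  initial≗phase₁ (true ∷ false ∷ true ∷ y) = refl
  initial≗phase₁ (false ∷ true ∷ true ∷ y) = refl
  initial≗phase₁ (true ∷ true ∷ true ∷ y) = refl

  phase₁-resp : Resp phase₁
  phase₁-resp D D' D≗D' (false ∷ false ∷ false ∷ y) = refl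
  phase₁-resp D D' D≗D' (true ∷ false ∷ false ∷ y) = refl
  phase₁-resp D D' D≗D' (false ∷ true ∷ false ∷ y) = refl
  phase₁-resp D D' D≗D' (false ∷ false ∷ true ∷ y) = cong blackIf (D≗D' y)
  phase₁-resp D D' D≗D' (true ∷ true ∷ false ∷ y) = refl
  phase₁-resp D D' D≗D' (true ∷ false ∷ true ∷ y) = refl
  phase₁-resp D D' D≗D' (false ∷ true ∷ true ∷ y) = refl
  phase₁-resp D D' D≗D' (true ∷ true ∷ true ∷ y) = refl

  phase₁-step : Step phase₁
  phase₁-step D D' y Dy D'y others =
    ⇝-move (force (v000 y) (v001 y) refl (cong blackIf Dy) (one-bit-apart y) only-v001 (cong blackIf D'y) unchanged)
    where
    only-v001 : ∀ x {m} → Adj (v000 y) x → phase₁ D x ≡ white m → x ≡ v001 y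
    only-v001 (false ∷ false ∷ true ∷ z) adj _ = cong v001 (column adj)
    only-v001 (false ∷ false ∷ false ∷ z) _ ()
    only-v001 (true ∷ false ∷ false ∷ z) _ ()
    only-v001 (false ∷ true ∷ false ∷ z) _ ()
    only-v001 (true ∷ true ∷ false ∷ z) () _
    only-v001 (true ∷ false ∷ true ∷ z) () _
    only-v001 (false ∷ true ∷ true ∷ z) () _
    only-v001 (true ∷ true ∷ true ∷ z) () _
    unchanged : ∀ x → x ≢ v001 y → phase₁ D' x ≡ phase₁ D x
    unchanged (false ∷ false ∷ true ∷ z) x≢w = cong blackIf (sym (others z (x≢w ∘ cong v001)))
    unchanged (false ∷ false ∷ false ∷ z) _ = refl
    unchanged (true ∷ false ∷ false ∷ z) _ = refl
    unchanged (false ∷ true ∷ false ∷ z) _ = refl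
    unchanged (true ∷ true ∷ false ∷ z) _ = refl
    unchanged (true ∷ false ∷ true ∷ z) _ = refl
    unchanged (false ∷ true ∷ true ∷ z) _ = refl
    unchanged (true ∷ true ∷ true ∷ z) _ = refl

  phase₃ : (Vertex k → Bool) → State
  phase₃ D (true ∷ true ∷ true ∷ y) = blackIf (D y)
  phase₃ D (_ ∷ _ ∷ _ ∷ y) = black

  phase₃-resp : Resp phase₃
  phase₃-resp D D' D≗D' (true ∷ true ∷ true ∷ y) = cong blackIf (D≗D' y)
  phase₃-resp D D' D≗D' (false ∷ false ∷ false ∷ y) = refl
  phase₃-resp D D' D≗D' (true ∷ false ∷ false ∷ y) = refl
  phase₃-resp D D' D≗D' (false ∷ true ∷ false ∷ y) = refl
  phase₃-resp D D' D≗D' (false ∷ false ∷ true ∷ y) = refl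
  phase₃-resp D D' D≗D' (true ∷ true ∷ false ∷ y) = refl
  phase₃-resp D D' D≗D' (true ∷ false ∷ true ∷ y) = refl
  phase₃-resp D D' D≗D' (false ∷ true ∷ true ∷ y) = refl

  phase₃-all-black : AllBlack (phase₃ (λ _ → true))
  phase₃-all-black (true ∷ true ∷ true ∷ y) = refl
  phase₃-all-black (false ∷ false ∷ false ∷ y) = refl
  phase₃-all-black (true ∷ false ∷ false ∷ y) = refl
  phase₃-all-black (false ∷ true ∷ false ∷ y) = refl
  phase₃-all-black (false ∷ false ∷ true ∷ y) = refl
  phase₃-all-black (true ∷ true ∷ false ∷ y) = refl
  phase₃-all-black (true ∷ false ∷ true ∷ y) = refl
  phase₃-all-black (false ∷ true ∷ true ∷ y) = refl

  phase₃-step : Step phase₃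
  phase₃-step D D' y Dy D'y others =
    ⇝-move (force (v110 y) (v111 y) refl (cong blackIf Dy) (one-bit-apart y) only-v111 (cong blackIf D'y) unchanged)
    where
    only-v111 : ∀ x {m} → Adj (v110 y) x → phase₃ D x ≡ white m → x ≡ v111 y
    only-v111 (true ∷ true ∷ true ∷ z) adj _ = cong v111 (column adj)
    only-v111 (false ∷ false ∷ false ∷ z) _ ()
    only-v111 (true ∷ false ∷ false ∷ z) _ ()
    only-v111 (false ∷ true ∷ false ∷ z) _ ()
    only-v111 (false ∷ false ∷ true ∷ z) _ ()
    only-v111 (true ∷ true ∷ false ∷ z) _ ()
    only-v111 (true ∷ false ∷ true ∷ z) _ ()
    only-v111 (false ∷ true ∷ true ∷ z) _ ()
    unchanged : ∀ x → x ≢ v111 y → phase₃ D' x ≡ phase₃ D x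
    unchanged (true ∷ true ∷ true ∷ z) x≢w = cong blackIf (sym (others z (x≢w ∘ cong v111)))
    unchanged (false ∷ false ∷ false ∷ z) _ = refl
    unchanged (true ∷ false ∷ false ∷ z) _ = refl
    unchanged (false ∷ true ∷ false ∷ z) _ = refl
    unchanged (false ∷ false ∷ true ∷ z) _ = refl
    unchanged (true ∷ true ∷ false ∷ z) _ = refl
    unchanged (true ∷ false ∷ true ∷ z) _ = refl
    unchanged (false ∷ true ∷ true ∷ z) _ = refl

  -- Phase 2: in each column, rules (d), (c), (c), (b), (a) in turn blacken v101, v011 and v110.
  data Stage : Set where
    start marked011 marked110 marked101 forced101 done : Stage

  cell110 cell101 cell011 : Stage → Cell
  cell110 start = unmarked
  cell110 marked011 = unmarked
  cell110 marked110 = white (just minus)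
  cell110 marked101 = white (just minus)
  cell110 forced101 = white (just minus)
  cell110 done = black
  cell101 start = unmarked
  cell101 marked011 = unmarked
  cell101 marked110 = unmarked
  cell101 marked101 = white (just plus)
  cell101 forced101 = black
  cell101 done = black
  cell011 start = unmarked
  cell011 marked011 = white (just plus)
  cell011 marked110 = white (just plus)
  cell011 marked101 = white (just plus)
  cell011 forced101 = black
  cell011 done = black

  phase₂ : (Vertex k → Stage) → State
  phase₂ σ (false ∷ false ∷ false ∷ y) = black
  phase₂ σ (true ∷ false ∷ false ∷ y) = black
  phase₂ σ (false ∷ true ∷ false ∷ y) = black
  phase₂ σ (false ∷ false ∷ true ∷ y) = black
  phase₂ σ (true ∷ true ∷ false ∷ y) = cell110 (σ y)
  phase₂ σ (true ∷ false ∷ true ∷ y) = cell101 (σ y)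
  phase₂ σ (false ∷ true ∷ true ∷ y) = cell011 (σ y)
  phase₂ σ (true ∷ true ∷ true ∷ y) = unmarked

  phase₂-resp : ∀ σ σ' → σ ≗ σ' → phase₂ σ ≗ phase₂ σ'
  phase₂-resp σ σ' σ≗σ' (false ∷ false ∷ false ∷ y) = refl
  phase₂-resp σ σ' σ≗σ' (true ∷ false ∷ false ∷ y) = refl
  phase₂-resp σ σ' σ≗σ' (false ∷ true ∷ false ∷ y) = refl
  phase₂-resp σ σ' σ≗σ' (false ∷ false ∷ true ∷ y) = refl
  phase₂-resp σ σ' σ≗σ' (true ∷ true ∷ false ∷ y) = cong cell110 (σ≗σ' y)
  phase₂-resp σ σ' σ≗σ' (true ∷ false ∷ true ∷ y) = cong cell101 (σ≗σ' y)
  phase₂-resp σ σ' σ≗σ' (false ∷ true ∷ true ∷ y) = cong cell011 (σ≗σ' y)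
  phase₂-resp σ σ' σ≗σ' (true ∷ true ∷ true ∷ y) = refl

  phase₂≗phase₁ : phase₂ (λ _ → start) ≗ phase₁ (λ _ → true)
  phase₂≗phase₁ (false ∷ false ∷ false ∷ y) = refl
  phase₂≗phase₁ (true ∷ false ∷ false ∷ y) = refl
  phase₂≗phase₁ (false ∷ true ∷ false ∷ y) = refl
  phase₂≗phase₁ (false ∷ false ∷ true ∷ y) = refl
  phase₂≗phase₁ (true ∷ true ∷ false ∷ y) = refl
  phase₂≗phase₁ (true ∷ false ∷ true ∷ y) = refl
  phase₂≗phase₁ (false ∷ true ∷ true ∷ y) = refl
  phase₂≗phase₁ (true ∷ true ∷ true ∷ y) = refl

  phase₃≗phase₂ : phase₃ (λ _ → false) ≗ phase₂ (λ _ → done)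
  phase₃≗phase₂ (false ∷ false ∷ false ∷ y) = refl
  phase₃≗phase₂ (true ∷ false ∷ false ∷ y) = refl
  phase₃≗phase₂ (false ∷ true ∷ false ∷ y) = refl
  phase₃≗phase₂ (false ∷ false ∷ true ∷ y) = refl
  phase₃≗phase₂ (true ∷ true ∷ false ∷ y) = refl
  phase₃≗phase₂ (true ∷ false ∷ true ∷ y) = refl
  phase₃≗phase₂ (false ∷ true ∷ true ∷ y) = refl
  phase₃≗phase₂ (true ∷ true ∷ true ∷ y) = refl

  white-neighbours-of-v010 : ∀ σ y x {m} → Adj (v010 y) x → phase₂ σ x ≡ white m → x ≡ v110 y ⊎ x ≡ v011 y
  white-neighbours-of-v010 σ y (true ∷ true ∷ false ∷ z) adj _ = inj₁ (cong v110 (column adj))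
  white-neighbours-of-v010 σ y (false ∷ true ∷ true ∷ z) adj _ = inj₂ (cong v011 (column adj))
  white-neighbours-of-v010 σ y (false ∷ false ∷ false ∷ z) _ ()
  white-neighbours-of-v010 σ y (true ∷ false ∷ false ∷ z) () _
  white-neighbours-of-v010 σ y (false ∷ true ∷ false ∷ z) _ ()
  white-neighbours-of-v010 σ y (false ∷ false ∷ true ∷ z) () _
  white-neighbours-of-v010 σ y (true ∷ false ∷ true ∷ z) () _
  white-neighbours-of-v010 σ y (true ∷ true ∷ true ∷ z) () _

  white-neighbours-of-v100 : ∀ σ y x {m} → Adj (v100 y) x → phase₂ σ x ≡ white m → x ≡ v110 y ⊎ x ≡ v101 y
  white-neighbours-of-v100 σ y (true ∷ true ∷ false ∷ z) adj _ = inj₁ (cong v110 (column adj))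
  white-neighbours-of-v100 σ y (true ∷ false ∷ true ∷ z) adj _ = inj₂ (cong v101 (column adj))
  white-neighbours-of-v100 σ y (false ∷ false ∷ false ∷ z) _ ()
  white-neighbours-of-v100 σ y (true ∷ false ∷ false ∷ z) _ ()
  white-neighbours-of-v100 σ y (false ∷ true ∷ false ∷ z) () _
  white-neighbours-of-v100 σ y (false ∷ false ∷ true ∷ z) () _
  white-neighbours-of-v100 σ y (false ∷ true ∷ true ∷ z) () _
  white-neighbours-of-v100 σ y (true ∷ true ∷ true ∷ z) () _

  white-neighbours-of-v001 : ∀ σ y x {m} → Adj (v001 y) x → phase₂ σ x ≡ white m → x ≡ v101 y ⊎ x ≡ v011 y
  white-neighbours-of-v001 σ y (true ∷ false ∷ true ∷ z) adj _ = inj₁ (cong v101 (column adj))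
  white-neighbours-of-v001 σ y (false ∷ true ∷ true ∷ z) adj _ = inj₂ (cong v011 (column adj))
  white-neighbours-of-v001 σ y (false ∷ false ∷ false ∷ z) _ ()
  white-neighbours-of-v001 σ y (true ∷ false ∷ false ∷ z) () _
  white-neighbours-of-v001 σ y (false ∷ true ∷ false ∷ z) () _
  white-neighbours-of-v001 σ y (false ∷ false ∷ true ∷ z) _ ()
  white-neighbours-of-v001 σ y (true ∷ true ∷ false ∷ z) () _
  white-neighbours-of-v001 σ y (true ∷ true ∷ true ∷ z) () _

  module ColumnMove (σ σ' : Vertex k → Stage) (y : Vertex k) (off-y : ∀ z → z ≢ y → σ z ≡ σ' z) where
    s s' : State
    s = phase₂ σ
    s' = phase₂ σ'

    same-off : (cell : Stage → Cell) → ∀ z → z ≢ y → cell (σ' z) ≡ cell (σ z)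
    same-off cell z z≢y = cong cell (sym (off-y z z≢y))

    same-at : ∀ {j j'} → σ y ≡ j → σ' y ≡ j' → (cell : Stage → Cell) → cell j ≡ cell j' →
      ∀ z → cell (σ' z) ≡ cell (σ z)
    same-at σy σ'y cell same z with z ≟ᵥ y
    ... | yes refl = trans (cong cell σ'y) (trans (sym same) (sym (cong cell σy)))
    ... | no z≢y = same-off cell z z≢y

    cell-at : ∀ {j c} (cell : Stage → Cell) → σ y ≡ j → cell (σ y) ≡ c → cell j ≡ c
    cell-at cell refl e = e

    white-inj : ∀ {m m'} → white m ≡ white m' → m ≡ m'
    white-inj refl = refl

    mark011 : σ y ≡ start → σ' y ≡ marked011 → (∀ z → σ z ≡ start ⊎ σ z ≡ done) → Move s s'
    mark011 σy σ'y start-or-done = ruleD (v011 y) all-unmarked (cong cell011 σy) (cong cell011 σ'y , unchanged)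
      where
      unmarked-cell : ∀ (cell : Stage → Cell) → cell start ≡ unmarked → cell done ≡ black →
        ∀ z {m} → cell (σ z) ≡ white m → m ≡ nothing
      unmarked-cell cell cs cd z e with start-or-done z
      ... | inj₁ σz = sym (white-inj (trans (sym (trans (cong cell σz) cs)) e))
      ... | inj₂ σz with () ← trans (sym (trans (cong cell σz) cd)) e
      all-unmarked : ∀ x m → s x ≡ white m → m ≡ nothing
      all-unmarked (true ∷ true ∷ false ∷ z) m = unmarked-cell cell110 refl refl z
      all-unmarked (true ∷ false ∷ true ∷ z) m = unmarked-cell cell101 refl refl z
      all-unmarked (false ∷ true ∷ true ∷ z) m = unmarked-cell cell011 refl refl z
      all-unmarked (true ∷ true ∷ true ∷ z) m = sym ∘ white-inj
      all-unmarked (false ∷ false ∷ false ∷ z) m ()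
      all-unmarked (true ∷ false ∷ false ∷ z) m ()
      all-unmarked (false ∷ true ∷ false ∷ z) m ()
      all-unmarked (false ∷ false ∷ true ∷ z) m ()
      unchanged : ∀ x → x ≢ v011 y → s' x ≡ s x
      unchanged (false ∷ true ∷ true ∷ z) x≢w = same-off cell011 z (x≢w ∘ cong v011)
      unchanged (true ∷ true ∷ false ∷ z) _ = same-at σy σ'y cell110 refl z
      unchanged (true ∷ false ∷ true ∷ z) _ = same-at σy σ'y cell101 refl z
      unchanged (false ∷ false ∷ false ∷ z) _ = refl
      unchanged (true ∷ false ∷ false ∷ z) _ = refl
      unchanged (false ∷ true ∷ false ∷ z) _ = refl
      unchanged (false ∷ false ∷ true ∷ z) _ = refl
      unchanged (true ∷ true ∷ true ∷ z) _ = refl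

    mark110 : σ y ≡ marked011 → σ' y ≡ marked110 → Move s s'
    mark110 σy σ'y =
      markVia (v010 y) (v110 y) minus refl (v011 y , one-bit-apart y , cong cell011 σy) marked-plus
        (cong cell110 σy) (one-bit-apart y) only-v110 (cong cell110 σ'y , unchanged)
      where
      marked-plus : ∀ x {μ} → Adj (v010 y) x → s x ≡ white (just μ) → μ ≡ plus
      marked-plus x adj sx with white-neighbours-of-v010 σ y x adj sx
      ... | inj₁ refl with () ← cell-at cell110 σy sx
      ... | inj₂ refl with refl ← cell-at cell011 σy sx = refl
      only-v110 : ∀ x → Adj (v010 y) x → s x ≡ unmarked → x ≡ v110 y
      only-v110 x adj sx with white-neighbours-of-v010 σ y x adj sx
      ... | inj₁ x≡w = x≡w
      ... | inj₂ refl with () ← cell-at cell011 σy sx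
      unchanged : ∀ x → x ≢ v110 y → s' x ≡ s x
      unchanged (true ∷ true ∷ false ∷ z) x≢w = same-off cell110 z (x≢w ∘ cong v110)
      unchanged (true ∷ false ∷ true ∷ z) _ = same-at σy σ'y cell101 refl z
      unchanged (false ∷ true ∷ true ∷ z) _ = same-at σy σ'y cell011 refl z
      unchanged (false ∷ false ∷ false ∷ z) _ = refl
      unchanged (true ∷ false ∷ false ∷ z) _ = refl
      unchanged (false ∷ true ∷ false ∷ z) _ = refl
      unchanged (false ∷ false ∷ true ∷ z) _ = refl
      unchanged (true ∷ true ∷ true ∷ z) _ = refl

    mark101 : σ y ≡ marked110 → σ' y ≡ marked101 → Move s s'
    mark101 σy σ'y =
      markVia (v100 y) (v101 y) plus refl (v110 y , one-bit-apart y , cong cell110 σy) marked-minus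
        (cong cell101 σy) (one-bit-apart y) only-v101 (cong cell101 σ'y , unchanged)
      where
      marked-minus : ∀ x {μ} → Adj (v100 y) x → s x ≡ white (just μ) → μ ≡ minus
      marked-minus x adj sx with white-neighbours-of-v100 σ y x adj sx
      ... | inj₁ refl with refl ← cell-at cell110 σy sx = refl
      ... | inj₂ refl with () ← cell-at cell101 σy sx
      only-v101 : ∀ x → Adj (v100 y) x → s x ≡ unmarked → x ≡ v101 y
      only-v101 x adj sx with white-neighbours-of-v100 σ y x adj sx
      ... | inj₁ refl with () ← cell-at cell110 σy sx
      ... | inj₂ x≡w = x≡w
      unchanged : ∀ x → x ≢ v101 y → s' x ≡ s x
      unchanged (true ∷ false ∷ true ∷ z) x≢w = same-off cell101 z (x≢w ∘ cong v101)
      unchanged (true ∷ true ∷ false ∷ z) _ = same-at σy σ'y cell110 refl z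
      unchanged (false ∷ true ∷ true ∷ z) _ = same-at σy σ'y cell011 refl z
      unchanged (false ∷ false ∷ false ∷ z) _ = refl
      unchanged (true ∷ false ∷ false ∷ z) _ = refl
      unchanged (false ∷ true ∷ false ∷ z) _ = refl
      unchanged (false ∷ false ∷ true ∷ z) _ = refl
      unchanged (true ∷ true ∷ true ∷ z) _ = refl

    force101 : σ y ≡ marked101 → σ' y ≡ forced101 → Move s s'
    force101 σy σ'y = forceMarked (v001 y) plus refl marked-plus (λ x → blackened x , unchanged x)
      where
      marked-plus : ∀ x {m} → Adj (v001 y) x → s x ≡ white m → m ≡ just plus
      marked-plus x adj sx with white-neighbours-of-v001 σ y x adj sx
      ... | inj₁ refl = sym (white-inj (cell-at cell101 σy sx))
      ... | inj₂ refl = sym (white-inj (cell-at cell011 σy sx))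
      blackened : ∀ x → InW s (v001 y) x → s' x ≡ black
      blackened x (_ , _ , sx , pz) with white-neighbours-of-v001 σ y x (proj₁ (PZ-sgn⇒Adj (v001 y) x pz)) sx
      ... | inj₁ refl = cong cell101 σ'y
      ... | inj₂ refl = cong cell011 σ'y
      unchanged : ∀ x → ¬ InW s (v001 y) x → s' x ≡ s x
      unchanged (true ∷ false ∷ true ∷ z) x∉W with z ≟ᵥ y
      ... | yes refl = ⊥-elim (x∉W (just plus , minus , cong cell101 σy , PZ-adjacent (v001 y) (v101 y) (one-bit-apart y)))
      ... | no z≢y = same-off cell101 z z≢y
      unchanged (false ∷ true ∷ true ∷ z) x∉W with z ≟ᵥ y
      ... | yes refl = ⊥-elim (x∉W (just plus , minus , cong cell011 σy , PZ-adjacent (v001 y) (v011 y) (one-bit-apart y)))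
      ... | no z≢y = same-off cell011 z z≢y
      unchanged (true ∷ true ∷ false ∷ z) _ = same-at σy σ'y cell110 refl z
      unchanged (false ∷ false ∷ false ∷ z) _ = refl
      unchanged (true ∷ false ∷ false ∷ z) _ = refl
      unchanged (false ∷ true ∷ false ∷ z) _ = refl
      unchanged (false ∷ false ∷ true ∷ z) _ = refl
      unchanged (true ∷ true ∷ true ∷ z) _ = refl

    force110 : σ y ≡ forced101 → σ' y ≡ done → Move s s'
    force110 σy σ'y = force (v010 y) (v110 y) refl (cong cell110 σy) (one-bit-apart y) only-v110 (cong cell110 σ'y) unchanged
      where
      only-v110 : ∀ x {m} → Adj (v010 y) x → s x ≡ white m → x ≡ v110 y
      only-v110 x adj sx with white-neighbours-of-v010 σ y x adj sx
      ... | inj₁ x≡w = x≡w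
      ... | inj₂ refl with () ← cell-at cell011 σy sx
      unchanged : ∀ x → x ≢ v110 y → s' x ≡ s x
      unchanged (true ∷ true ∷ false ∷ z) x≢w = same-off cell110 z (x≢w ∘ cong v110)
      unchanged (true ∷ false ∷ true ∷ z) _ = same-at σy σ'y cell101 refl z
      unchanged (false ∷ true ∷ true ∷ z) _ = same-at σy σ'y cell011 refl z
      unchanged (false ∷ false ∷ false ∷ z) _ = refl
      unchanged (true ∷ false ∷ false ∷ z) _ = refl
      unchanged (false ∷ true ∷ false ∷ z) _ = refl
      unchanged (false ∷ false ∷ true ∷ z) _ = refl
      unchanged (true ∷ true ∷ true ∷ z) _ = refl

  toStage : Bool → Stage
  toStage false = start
  toStage true = done

  toStage-start-or-done : ∀ b → toStage b ≡ start ⊎ toStage b ≡ done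
  toStage-start-or-done false = inj₁ refl
  toStage-start-or-done true = inj₂ refl

  phase₂′ : (Vertex k → Bool) → State
  phase₂′ D = phase₂ (toStage ∘ D)

  phase₂′-resp : Resp phase₂′
  phase₂′-resp D D' D≗D' = phase₂-resp _ _ (cong toStage ∘ D≗D')

  phase₂′-step : Step phase₂′
  phase₂′-step D D' y Dy D'y others =
    ⇝-≗ (phase₂-resp _ _ at-start) ▸
    move start marked011 (λ σy σ'y off → ColumnMove.mark011 _ _ y off σy σ'y start-or-done) ▸
    move marked011 marked110 (λ σy σ'y off → ColumnMove.mark110 _ _ y off σy σ'y) ▸
    move marked110 marked101 (λ σy σ'y off → ColumnMove.mark101 _ _ y off σy σ'y) ▸
    move marked101 forced101 (λ σy σ'y off → ColumnMove.force101 _ _ y off σy σ'y) ▸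
    move forced101 done (λ σy σ'y off → ColumnMove.force110 _ _ y off σy σ'y) ▸
    ⇝-≗ (phase₂-resp _ _ at-done)
    where
    stages : Stage → Vertex k → Stage
    stages j z with z ≟ᵥ y
    ... | yes _ = j
    ... | no _ = toStage (D z)

    stages-y : ∀ j → stages j y ≡ j
    stages-y j with y ≟ᵥ y
    ... | yes _ = refl
    ... | no y≢y = ⊥-elim (y≢y refl)

    stages-off : ∀ j j' z → z ≢ y → stages j z ≡ stages j' z
    stages-off j j' z z≢y with z ≟ᵥ y
    ... | yes z≡y = ⊥-elim (z≢y z≡y)
    ... | no _ = refl

    start-or-done : ∀ z → stages start z ≡ start ⊎ stages start z ≡ done
    start-or-done z with z ≟ᵥ y
    ... | yes _ = inj₁ refl
    ... | no _ = toStage-start-or-done (D z)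

    at-start : ∀ z → stages start z ≡ toStage (D z)
    at-start z with z ≟ᵥ y
    ... | yes refl = cong toStage (sym Dy)
    ... | no _ = refl

    at-done : ∀ z → toStage (D' z) ≡ stages done z
    at-done z with z ≟ᵥ y
    ... | yes refl = cong toStage D'y
    ... | no z≢y = cong toStage (sym (others z z≢y))

    move : ∀ j j' → (stages j y ≡ j → stages j' y ≡ j' → (∀ z → z ≢ y → stages j z ≡ stages j' z) →
                     Move (phase₂ (stages j)) (phase₂ (stages j'))) →
           phase₂ (stages j) ⇝ phase₂ (stages j')
    move j j' m = ⇝-move (m (stages-y j) (stages-y j') (stages-off j j'))

  play : initial S ⇝ phase₃ (λ _ → true)
  play =
    ⇝-≗ (sym ∘ initial≗phase₁) ▸ sweep k phase₁ phase₁-step phase₁-resp ▸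
    ⇝-≗ phase₂≗phase₁ ▸ sweep k phase₂′ phase₂′-step phase₂′-resp ▸
    ⇝-≗ phase₃≗phase₂ ▸ sweep k phase₃ phase₃-step phase₃-resp

  S-SignedZFS : SignedZFSQ Q S
  S-SignedZFS = ⇝-SignedZFS play phase₃-all-black

  count-true : ∀ n → count {n} (λ _ → true) ≡ 2 ^ n
  count-true zero = refl
  count-true (suc n) = trans (cong₂ _+_ (count-true n) (count-true n)) (cong (2 ^ n +_) (sym (ℕ.+-identityʳ (2 ^ n))))

  count-false : ∀ n → count {n} (λ _ → false) ≡ 0
  count-false zero = refl
  count-false (suc n) = cong₂ _+_ (count-false n) (count-false n)

  count-S : count S ≡ 3 * 2 ^ k
  count-S rewrite count-true k | count-false k = three-copies (2 ^ k)
    where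
    -- the shape of count S, which splits along the three leading coordinates
    three-copies : ∀ a → ((a + 0) + (a + 0)) + ((a + 0) + (0 + 0)) ≡ 3 * a
    three-copies = solve-∀

signed-zero-forcing-set : ∀ d → 3 ≤ d → ∃ λ (S : Vertex d → Bool) → SignedZFSQ d S × count S ≤ 3 * 2 ^ (d ∸ 3)
signed-zero-forcing-set (suc (suc (suc k))) (s≤s (s≤s (s≤s z≤n))) =
  Construction.S k , Construction.S-SignedZFS k , ℕ.≤-reflexive (Construction.count-S k)

mainTheorem3 : (ℝ : RealField) → (d : ℕ) → 3 ≤ d →
    ((A : LinAlg.Matrix ℝ d) → LinAlg.Symmetric ℝ A → LinAlg.HasGraphQ ℝ A → LinAlg.InZ ℝ A →
      (S : Vertex d → Bool) → SignedZFSQ d S → LinAlg.NullityAtMost ℝ A (count S))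
    × (∃ λ (S : Vertex d → Bool) → SignedZFSQ d S × count S ≤ 3 * 2 ^ (d ∸ 3))
mainTheorem3 ℝ d 3≤d = (λ A _ graph inZ → nullity-bound ℝ A graph inZ) , signed-zero-forcing-set d 3≤d
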